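{- Let $\mathbf{k}$ be a field in which $|G|$ is invertible, $0\le\ell\le n$. (a) For each $\ell$-element subset $U\subseteq\{1,\ldots,n\}$, the image $\overline{\mathbf{k}\mathscr{F}_{U,\ell}}$ of $\mathbf{k}\mathscr{F}_{U,\ell}$ in $\mathbf{k}\mathscr{F}_{n,\ge\ell}/\mathbf{k}\mathscr{F}_{n,\ge\ell+1}$ is a $\mathbf{k}\mathscr{F}_n$-submodule, annihilated by $(i)$ for every $i\notin U$; consequently $x\cdot\bar{\mathbf{a}}=x_U\cdot\bar{\mathbf{a}}$ for all $\bar{\mathbf{a}}\in\overline{\mathbf{k}\mathscr{F}_{U,\ell}}$. (b) For each $\ell$-dimensional subspace $U\subseteq\mathbb{F}_q^n$, the image $\overline{\mathbf{k}\mathscr{F}^{(q)}_{U,\ell}}$ of $\mathbf{k}\mathscr{F}^{(q)}_{U,\ell}$ in $\mathbf{k}\mathscr{F}^{(q)}_{n,\ge\ell}/\mathbf{k}\mathscr{F}^{(q)}_{n,\ge\ell+1}$ is a $\mathbf{k}\mathscr{F}^{(q)}_n$-submodule, annihilated by $(L)$ for every line $L\not\subseteq U$; consequently $x^{(q)}\cdot\bar{\mathbf{A}}=x^{(q)}_U\cdot\bar{\mathbf{A}}$ for all $\bar{\mathbf{A}}\in\overline{\mathbf{k}\mathscr{F}^{(q)}_{U,\ell}}$.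
   Context: $\mathscr{F}_n$ is the monoid of words $(a_1,\ldots,a_\ell)$ in letters $\{1,\ldots,n\}$ without repeated letters (length $\ell$), with product $(a_1,\ldots,a_\ell)\cdot(b_1,\ldots,b_m)=(a_1,\ldots,a_\ell,b_1,\ldots,b_m)^\wedge$, where $^\wedge$ deletes every entry already occurring earlier; $G=\mathfrak{S}_n$ in part (a). For a prime power $q$, $\mathscr{F}^{(q)}_n$ is the monoid of partial flags $(A_1\subset\cdots\subset A_\ell)$ in $\mathbb{F}_q^n$ with $\dim A_i=i$ (length $\ell$), with product $(A_1,\ldots,A_\ell)\cdot(B_1,\ldots,B_m)=(A_1,\ldots,A_\ell,A_\ell+B_1,\ldots,A_\ell+B_m)^\wedge$ (deleting repeated subspaces); $G=GL_n(\mathbb{F}_q)$ in part (b). $\mathbf{k}\mathscr{F}_{n,\ge\ell}$ (resp. $\mathbf{k}\mathscr{F}^{(q)}_{n,\ge\ell}$) is the $\mathbf{k}$-span of elements of length $\ge\ell$ in the monoid algebra; these are left ideals. For $U\subseteq\{1,\ldots,n\}$, $\mathscr{F}_{U,\ell}$ is the set of words of length $\ell$ using only letters from $U$, and $x_U=\sum_{i\in U}(i)$; $x=x_{\{1,\ldots,n\}}$. For a subspace $U$, $\mathscr{F}^{(q)}_{U,\ell}$ is the set of length-$\ell$ flags of subspaces of $U$, and $x^{(q)}_U=\sum_{\text{lines }L\subseteq U}(L)$; $x^{(q)}=x^{(q)}_{\mathbb{F}_q^n}$. -}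

module Defs where

open import Level using (Level; 0ℓ)
open import Data.Bool using (Bool; true; false; _∧_; _∨_; not; T)
open import Data.Nat using (ℕ; zero; suc; _<_; _∸_; _^_)
open import Data.Nat using (_!)
open import Data.Fin using (Fin)
open import Data.Fin.Properties using () renaming (_≟_ to _≟Fin_)
open import Data.Fin.Subset using (Subset)
open import Data.List using (List; []; _∷_; _++_; map; concatMap; foldr; filterᵇ; deduplicateᵇ; allFin; length)
open import Data.Bool.ListAction using (any; all)
open import Data.List.Relation.Unary.All using (All)
open import Data.List.Relation.Unary.Unique.Propositional using (Unique)
open import Data.List.Membership.Propositional using (_∈_)
open import Data.Vec using (Vec; []; _∷_; zipWith; replicate; lookup)
open import Data.Product using (Σ; ∃; _×_; _,_; proj₁; proj₂)
open import Data.Unit using (⊤)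
open import Relation.Nullary using (¬_; does)
open import Relation.Binary using (DecidableEquality)
open import Relation.Binary.PropositionalEquality using (_≡_)
open import Algebra.Bundles using (CommutativeRing)
open import Algebra.Structures using (IsCommutativeRing)
open import Function using (_⇔_)

record Field (c r : Level) : Set (Level.suc (c Level.⊔ r)) where
  field
    commutativeRing : CommutativeRing c r
  open CommutativeRing commutativeRing public
  field
    1≉0     : ¬ (1# ≈ 0#)
    inverse : ∀ x → ¬ (x ≈ 0#) → ∃ λ y → x * y ≈ 1#

module _ {c r} (K : Field c r) where
  open Field K
  fromℕ : ℕ → Carrier
  fromℕ zero    = 0#
  fromℕ (suc m) = 1# + fromℕ m

  InvertibleIn : ℕ → Set (c Level.⊔ r)
  InvertibleIn m = ∃ λ y → fromℕ m * y ≈ 1#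

-- Monoid algebra k[M] of a monoid M with Boolean equality test,
-- represented by formal finite linear combinations  Σ c_j m_j .

module FormalSums {c r} (K : Field c r) {M : Set} (eqM : M → M → Bool)
                  (_·_ : M → M → M) (len : M → ℕ) where
  open Field K

  FS : Set c
  FS = List (Carrier × M)

  coeff : FS → M → Carrier
  coeff []             m = 0#
  coeff ((a , m') ∷ s) m = (if eqM m' m then a else 0#) + coeff s m
    where open import Data.Bool using (if_then_else_)

  basis : M → FS
  basis m = (1# , m) ∷ []

  _⊛_ : FS → FS → FS
  s ⊛ t = concatMap (λ { (a , m) → map (λ { (b , m') → (a * b , m · m') }) t }) s

  _⊝_ : FS → FS → FS
  s ⊝ t = s ++ map (λ { (a , m) → (- a , m) }) t

  InSpan : (M → Set) → FS → Set c
  InSpan P s = All (λ p → P (proj₂ p)) s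

  InGe : ℕ → FS → Set r
  InGe ℓ s = ∀ m → len m < ℓ → coeff s m ≈ 0#

  -- equality in the quotient  k M_{≥ ℓ} / k M_{≥ ℓ+1}
  _≈⟨mod_⟩_ : FS → ℕ → FS → Set r
  s ≈⟨mod ℓ ⟩ t = InGe (suc ℓ) (s ⊝ t)

-- Part (a): the free left-regular band  𝓕_n  of words without repetition.
-- Raw words are lists; genuine elements of 𝓕_n are the Unique ones.

Word : ℕ → Set
Word n = List (Fin n)

IsWord : ∀ {n} → Word n → Set
IsWord w = Unique w

eqWord : ∀ {n} → Word n → Word n → Bool
eqWord []       []       = true
eqWord (a ∷ v)  (b ∷ w)  = does (a ≟Fin b) ∧ eqWord v w
eqWord _        _        = false

_·W_ : ∀ {n} → Word n → Word n → Word n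
v ·W w = deduplicateᵇ (λ a b → does (a ≟Fin b)) (v ++ w)

module WordAlg {c r} (K : Field c r) (n : ℕ) =
  FormalSums K (eqWord {n}) _·W_ length

InFUW : ∀ {n} → Subset n → ℕ → Word n → Set
InFUW U ℓ w = IsWord w × length w ≡ ℓ × All (λ i → i Data.Fin.Subset.∈ U) w

xW : ∀ {c r} (K : Field c r) {n} → Subset n → WordAlg.FS K n
xW K {n} U = map (λ i → (Field.1# K , i ∷ [])) (filterᵇ (lookup U) (allFin n))

record FiniteField : Set₁ where
  infixl 7 _*_
  infixl 6 _+_
  field
    Carrier : Set
    _+_ _*_ : Carrier → Carrier → Carrier
    -_      : Carrier → Carrier
    0# 1#   : Carrier
    isCommutativeRing : IsCommutativeRing _≡_ _+_ _*_ -_ 0# 1#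
    1≢0     : ¬ (1# ≡ 0#)
    inverse : ∀ x → ¬ (x ≡ 0#) → ∃ λ y → x * y ≡ 1#
    _≟_     : DecidableEquality Carrier
    elems          : List Carrier
    elems-unique   : Unique elems
    elems-complete : ∀ a → a ∈ elems

  order : ℕ
  order = length elems

module Flags (F : FiniteField) (n : ℕ) where
  open FiniteField F

  V : Set
  V = Vec Carrier n

  _+V_ : V → V → V
  _+V_ = zipWith _+_

  _∙V_ : Carrier → V → V
  a ∙V v = Data.Vec.map (a *_) v

  0V : V
  0V = replicate n 0#

  eqV : V → V → Bool
  eqV v w = Data.Vec.foldr (λ _ → Bool) _∧_ true (zipWith (λ a b → does (a ≟ b)) v w)

  allVecs : ∀ m → List (Vec Carrier m)
  allVecs zero    = [] ∷ []
  allVecs (suc m) = concatMap (λ a → map (a ∷_) (allVecs m)) elems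

  Sub : Set
  Sub = V → Bool

  _∈S_ : V → Sub → Set
  v ∈S A = T (A v)

  _⊆S_ : Sub → Sub → Set
  A ⊆S B = ∀ v → v ∈S A → v ∈S B

  IsSubspace : Sub → Set
  IsSubspace A = 0V ∈S A × (∀ v w → v ∈S A → w ∈S A → (v +V w) ∈S A)
                        × (∀ a v → v ∈S A → (a ∙V v) ∈S A)

  lincomb : ∀ {d} → Vec Carrier d → Vec V d → V
  lincomb []       []       = 0V
  lincomb (a ∷ as) (v ∷ vs) = (a ∙V v) +V lincomb as vs

  LinIndep : ∀ {d} → Vec V d → Set
  LinIndep {d} bs = ∀ cs → lincomb cs bs ≡ 0V → cs ≡ replicate d 0#

  Dim : Sub → ℕ → Set
  Dim A d = Σ (Vec V d) λ bs → LinIndep bs × (∀ v → v ∈S A ⇔ (∃ λ cs → lincomb cs bs ≡ v))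

  eqSub : Sub → Sub → Bool
  eqSub A B = all (λ v → eqBool (A v) (B v)) (allVecs n)
    where
      eqBool : Bool → Bool → Bool
      eqBool true  b = b
      eqBool false b = not b

  zeroSub : Sub
  zeroSub v = eqV v 0V

  _+S_ : Sub → Sub → Sub
  (A +S B) v = any (λ a → A a ∧ B (v +V ((- 1#) ∙V a))) (allVecs n)

  span1 : V → Sub
  span1 v w = any (λ a → eqV (a ∙V v) w) elems

  IsLine : Sub → Set
  IsLine L = IsSubspace L × Dim L 1

  -- raw flags are lists of subsets; genuine partial flags satisfy IsFlag
  Flag : Set
  Flag = List Sub

  FlagFrom : Sub → ℕ → Flag → Set
  FlagFrom P d []       = ⊤
  FlagFrom P d (A ∷ As) = IsSubspace A × Dim A (suc d) × P ⊆S A × FlagFrom A (suc d) As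

  IsFlag : Flag → Set
  IsFlag = FlagFrom zeroSub 0

  eqFlag : Flag → Flag → Bool
  eqFlag []       []       = true
  eqFlag (A ∷ As) (B ∷ Bs) = eqSub A B ∧ eqFlag As Bs
  eqFlag _        _        = false

  lastSub : Flag → Sub
  lastSub []           = zeroSub
  lastSub (A ∷ [])     = A
  lastSub (_ ∷ B ∷ As) = lastSub (B ∷ As)

  _·F_ : Flag → Flag → Flag
  As ·F Bs = deduplicateᵇ eqSub (As ++ map (lastSub As +S_) Bs)

  InFU : Sub → ℕ → Flag → Set
  InFU U ℓ As = IsFlag As × length As ≡ ℓ × All (_⊆S U) As

  linesIn : Sub → List Sub
  linesIn U = deduplicateᵇ eqSub
    (map span1 (filterᵇ (λ v → U v ∧ not (eqV v 0V)) (allVecs n)))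

  fullSpace : Sub
  fullSpace _ = true

  orderGL : ℕ
  orderGL = go n
    where
      go : ℕ → ℕ
      go zero    = 1
      go (suc i) = (order ^ n ∸ order ^ i) Data.Nat.* go i

module FlagAlg {c r} (K : Field c r) (F : FiniteField) (n : ℕ) where
  open Flags F n public
  open FormalSums K eqFlag _·F_ length public

  xF : Sub → FS
  xF U = map (λ L → (Field.1# K , L ∷ [])) (linesIn U)

-- Everything rests on one dichotomy: if s lies in 𝓕_{U,ℓ} and a is any word
-- (flag), then a·s either lies in 𝓕_{U,ℓ} again or is longer than ℓ, i.e.
-- vanishes in k𝓕_{≥ℓ}/k𝓕_{≥ℓ+1}.  For words, a·s contains every letter of s,
-- so it is either a rearrangement of s or strictly longer.  For flags, the
-- subspaces of A·B before deleting repetitions form a chain whose dimensions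
-- grow by at most one (so deleting repetitions yields a flag), ending in
-- A_k + B_ℓ ⊇ B_ℓ; if A·B has length ≤ ℓ then dim (A_k + B_ℓ) ≤ ℓ forces
-- A_k + B_ℓ = B_ℓ ⊆ U.  Closure follows by discarding the long terms of a·s.
-- A product (i)·s begins with i (resp. (L)·B begins with L), so it cannot lie
-- in 𝓕_{U,ℓ} when i ∉ U (resp. L ⊈ U); hence (i) annihilates, and x, x_U act
-- alike because they differ by such generators.

module Submission where

open import Defs
open import Level using (0ℓ)
open import Function using (_∘_; _∘₂_; id; mk⇔; Equivalence)
open import Data.Bool using (Bool; true; false; not; T; _∧_; _∨_)
open import Data.Bool.Properties using (T-∧; ∧-identityʳ; ∧-zeroʳ)
open import Data.Bool.ListAction using (all)
open import Data.Empty using (⊥; ⊥-elim)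
open import Data.Nat using (ℕ; zero; suc; _≤_; _<_; _!; _^_; z≤n; s≤s; _≤?_)
open import Data.Nat.Properties
  using (≤-antisym; ≤-refl; ≤-trans; <⇒≱; ≰⇒>; ≮⇒≥; ^-monoʳ-<; <-irrefl; _<?_)
open import Data.Fin.Properties using () renaming (_≟_ to _≟ᶠ_)
open import Data.Fin.Subset using (Subset; ∣_∣; _∉_; ⊤)
open import Data.Fin.Subset.Properties using (∈⊤)
open import Data.Vec as Vec using (Vec; []; _∷_; zipWith; replicate; lookup)
open import Data.Vec.Properties using (≡-dec; []=⇒lookup; ∷-injectiveʳ)
open import Data.List
  using (List; []; _∷_; _++_; length; concatMap; map; filter; filterᵇ; deduplicate; deduplicateᵇ; allFin)
open import Data.List.Properties using (length-++; length-++-sucʳ; length-map; filter-all; filter-≐)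
open import Data.List.Relation.Unary.All as All using (All; []; _∷_; all?)
open import Data.List.Relation.Unary.All.Properties
  using (++⁺; map⁺; all-filter; filter⁺; ¬All⇒Any¬; all⁺; all⁻)
open import Data.List.Relation.Unary.Any as Any using (Any; here; there)
open import Data.List.Relation.Unary.Any.Properties using (any⁺; any⁻; deduplicate⁺)
open import Data.List.Relation.Unary.Unique.Propositional using (Unique; []; _∷_)
import Data.List.Relation.Unary.Unique.Propositional.Properties as Unique
open import Data.List.Relation.Unary.Unique.DecPropositional.Properties using (deduplicate-!)
open import Data.List.Membership.Propositional using (_∈_; find; lose)
open import Data.List.Membership.Propositional.Properties
  using (∈-∃++; ∈-++⁻; ∈-++⁺ˡ; ∈-++⁺ʳ; ∈-map⁺; ∈-map⁻; ∈-concatMap⁺; ∈-concatMap⁻;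
         ∈-filter⁻; ∈-deduplicate⁺; ∈-deduplicate⁻)
import Data.List.Membership.DecPropositional as DecMembership
open import Data.List.Relation.Binary.Subset.Propositional using (_⊆_)
open import Data.Product using (∃; _×_; _,_; proj₁; proj₂)
open import Data.Sum using (_⊎_; inj₁; inj₂; [_,_]′)
open import Relation.Nullary using (¬_; Dec; yes; no; does; ¬?; _→-dec_)
open import Relation.Nullary.Decidable using (T?)
open import Relation.Unary using (Decidable)
open import Relation.Binary using (DecidableEquality)
open import Relation.Binary.PropositionalEquality
  using (_≡_; _≗_; refl; sym; trans; cong; cong₂; subst; subst₂; module ≡-Reasoning)
open import Algebra.Bundles using (Ring)
open import Algebra.Structures using (IsCommutativeRing)
import Algebra.Properties.Ring as RingProperties
import Relation.Binary.Reasoning.Setoid as ≈-Reasoning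

T-ext : ∀ {x y} → (T x → T y) → (T y → T x) → x ≡ y
T-ext {true}  {true}  _ _ = refl
T-ext {false} {false} _ _ = refl
T-ext {true}  {false} f _ = ⊥-elim (f _)
T-ext {false} {true}  _ g = ⊥-elim (g _)

module _ {a} {A : Set a} where

  Unique-⊆⇒length≤ : {xs ys : List A} → Unique xs → xs ⊆ ys → length xs ≤ length ys
  Unique-⊆⇒length≤ {[]}     _               _     = z≤n
  Unique-⊆⇒length≤ {x ∷ xs} (x∉xs ∷ !xs) x∷xs⊆ys with ∈-∃++ (x∷xs⊆ys (here refl))
  ... | us , vs , refl =
    subst (suc (length xs) ≤_) (sym (length-++-sucʳ us x vs)) (s≤s (Unique-⊆⇒length≤ !xs xs⊆us++vs))
    where
      xs⊆us++vs : xs ⊆ us ++ vs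
      xs⊆us++vs {z} z∈xs with ∈-++⁻ us (x∷xs⊆ys (there z∈xs))
      ... | inj₁ z∈us          = ∈-++⁺ˡ z∈us
      ... | inj₂ (here refl)   = ⊥-elim (All.lookup x∉xs z∈xs refl)
      ... | inj₂ (there z∈vs)  = ∈-++⁺ʳ us z∈vs

  all-or-counterexample : ∀ {p} {P : A → Set p} → Decidable P → ∀ xs →
                          All P xs ⊎ ∃ λ x → x ∈ xs × ¬ P x
  all-or-counterexample P? xs with all? P? xs
  ... | yes all = inj₁ all
  ... | no ¬all = inj₂ (find (¬All⇒Any¬ P? xs ¬all))

  deduplicateᵇ-does : (_≟ᴬ_ : DecidableEquality A) →
                      deduplicateᵇ (λ x y → does (x ≟ᴬ y)) ≗ deduplicate _≟ᴬ_
  deduplicateᵇ-does _≟ᴬ_ []       = refl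
  deduplicateᵇ-does _≟ᴬ_ (x ∷ xs) = cong (x ∷_) (begin
    filter (λ y → ¬? (T? (does (x ≟ᴬ y)))) (deduplicateᵇ _ xs)
      ≡⟨ filter-≐ (λ y → ¬? (T? (does (x ≟ᴬ y)))) (λ y → ¬? (x ≟ᴬ y)) (¬T⇒≢ , ≢⇒¬T) (deduplicateᵇ _ xs) ⟩
    filter (λ y → ¬? (x ≟ᴬ y)) (deduplicateᵇ _ xs)
      ≡⟨ cong (filter _) (deduplicateᵇ-does _≟ᴬ_ xs) ⟩
    filter (λ y → ¬? (x ≟ᴬ y)) (deduplicate _≟ᴬ_ xs) ∎)
    where
      open ≡-Reasoning
      ¬T⇒≢ : ∀ {y} → ¬ T (does (x ≟ᴬ y)) → ¬ x ≡ y
      ¬T⇒≢ {y} ¬t x≡y with x ≟ᴬ y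
      ... | yes _  = ¬t _
      ... | no x≢y = x≢y x≡y
      ≢⇒¬T : ∀ {y} → ¬ x ≡ y → ¬ T (does (x ≟ᴬ y))
      ≢⇒¬T {y} x≢y t with x ≟ᴬ y
      ... | yes x≡y = x≢y x≡y

  filter-comm : ∀ {p q} {P : A → Set p} {Q : A → Set q} (P? : Decidable P) (Q? : Decidable Q) →
                filter P? ∘ filter Q? ≗ filter Q? ∘ filter P?
  filter-comm P? Q? []       = refl
  filter-comm P? Q? (x ∷ xs) with Q? x in eqQ | P? x in eqP
  ... | yes _ | yes _ rewrite eqP | eqQ = cong (x ∷_) (filter-comm P? Q? xs)
  ... | yes _ | no  _ rewrite eqP       = filter-comm P? Q? xs
  ... | no  _ | yes _ rewrite eqQ       = filter-comm P? Q? xs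
  ... | no  _ | no  _                   = filter-comm P? Q? xs

  filter-absorb : ∀ {p q} {P : A → Set p} {Q : A → Set q} (P? : Decidable P) (Q? : Decidable Q) →
                  (∀ {x} → P x → Q x) → filter P? ∘ filter Q? ≗ filter P?
  filter-absorb P? Q? P⇒Q []       = refl
  filter-absorb P? Q? P⇒Q (x ∷ xs) with Q? x | P? x in eqP
  ... | yes _ | yes _  rewrite eqP = cong (x ∷_) (filter-absorb P? Q? P⇒Q xs)
  ... | yes _ | no  _  rewrite eqP = filter-absorb P? Q? P⇒Q xs
  ... | no ¬q | yes px             = ⊥-elim (¬q (P⇒Q px))
  ... | no  _ | no  _              = filter-absorb P? Q? P⇒Q xs

  filterᵇ-deduplicateᵇ : ∀ (p : A → Bool) (r : A → A → Bool) → (∀ {x y} → T (r x y) → p x ≡ p y) →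
                         filterᵇ p ∘ deduplicateᵇ r ≗ deduplicateᵇ r ∘ filterᵇ p
  filterᵇ-deduplicateᵇ p r resp []       = refl
  filterᵇ-deduplicateᵇ p r resp (x ∷ xs) with p x in px
  ... | true  = cong (x ∷_) (trans (filter-comm (T? ∘ p) (¬? ∘ T? ∘ r x) (deduplicateᵇ r xs))
                                   (cong (filter (¬? ∘ T? ∘ r x)) (filterᵇ-deduplicateᵇ p r resp xs)))
  ... | false = trans (filter-absorb (T? ∘ p) (¬? ∘ T? ∘ r x) p⇒¬r (deduplicateᵇ r xs))
                      (filterᵇ-deduplicateᵇ p r resp xs)
    where
      p⇒¬r : ∀ {y} → T (p y) → ¬ T (r x y)
      p⇒¬r py rxy = subst T (trans (sym (resp rxy)) px) py

  filterᵇ-map : ∀ {b} {B : Set b} (p : B → Bool) (f : A → B) → filterᵇ p ∘ map f ≗ map f ∘ filterᵇ (p ∘ f)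
  filterᵇ-map p f []       = refl
  filterᵇ-map p f (x ∷ xs) with p (f x)
  ... | true  = cong (f x ∷_) (filterᵇ-map p f xs)
  ... | false = filterᵇ-map p f xs

  filterᵇ-filterᵇ : ∀ (p q r : A → Bool) → (∀ x → r x ≡ (q x ∧ p x)) → filterᵇ p ∘ filterᵇ q ≗ filterᵇ r
  filterᵇ-filterᵇ p q r r≡q∧p []       = refl
  filterᵇ-filterᵇ p q r r≡q∧p (x ∷ xs) with q x | r≡q∧p x
  ... | false | rx≡ rewrite rx≡ = filterᵇ-filterᵇ p q r r≡q∧p xs
  ... | true  | rx≡ with p x
  ...   | true  rewrite rx≡ = cong (x ∷_) (filterᵇ-filterᵇ p q r r≡q∧p xs)
  ...   | false rewrite rx≡ = filterᵇ-filterᵇ p q r r≡q∧p xs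

-- Monoid algebras modulo longer elements

module TruncatedProducts {c r} (K : Field c r) {M : Set} (eqM : M → M → Bool)
         (_·_ : M → M → M) (len : M → ℕ)
         (eqM⇒len≡ : ∀ a b → T (eqM a b) → len a ≡ len b) where

  open Field K renaming (refl to ≈-refl; sym to ≈-sym; trans to ≈-trans)
  open FormalSums K eqM _·_ len
  open RingProperties ring using (-0#≈0#; -‿+-comm)
  open ≈-Reasoning setoid

  coeff-++ : ∀ s t m → coeff (s ++ t) m ≈ coeff s m + coeff t m
  coeff-++ []      t m = ≈-sym (+-identityˡ _)
  coeff-++ (_ ∷ s) t m = ≈-trans (+-congˡ (coeff-++ s t m)) (≈-sym (+-assoc _ _ _))

  coeff-negate : ∀ t m → coeff ([] ⊝ t) m ≈ - coeff t m
  coeff-negate []             m = ≈-sym -0#≈0#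
  coeff-negate ((a , m′) ∷ t) m with eqM m′ m
  ... | true  = ≈-trans (+-congˡ (coeff-negate t m)) (-‿+-comm a (coeff t m))
  ... | false = ≈-trans (+-cong (≈-sym -0#≈0#) (coeff-negate t m)) (-‿+-comm 0# (coeff t m))

  coeff-⊝ : ∀ s t m → coeff (s ⊝ t) m ≈ coeff s m + - coeff t m
  coeff-⊝ s t m = ≈-trans (coeff-++ s ([] ⊝ t) m) (+-congˡ (coeff-negate t m))

  coeff-⊛-∷ : ∀ α x a s m → coeff (((α , x) ∷ a) ⊛ s) m ≈ coeff (((α , x) ∷ []) ⊛ s) m + coeff (a ⊛ s) m
  coeff-⊛-∷ α x a s m = split {map (λ { (b , m′) → (α * b , x · m′) }) s}
    where
      split : ∀ {p} → coeff (p ++ a ⊛ s) m ≈ coeff (p ++ []) m + coeff (a ⊛ s) m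
      split {p} = ≈-trans (coeff-++ p _ m) (+-congʳ (≈-sym (≈-trans (coeff-++ p [] m) (+-identityʳ _))))

  coeff-filter : ∀ {P : M → Set} (P? : Decidable P) X m →
    coeff X m ≈ coeff (filter (P? ∘ proj₂) X) m + coeff (filter (¬? ∘ P? ∘ proj₂) X) m
  coeff-filter P? []             m = ≈-sym (+-identityˡ _)
  coeff-filter P? ((a , m′) ∷ X) m with P? m′
  ... | yes _ = ≈-trans (+-congˡ (coeff-filter P? X m)) (≈-sym (+-assoc _ _ _))
  ... | no  _ = begin
    x + coeff X m  ≈⟨ +-congˡ (coeff-filter P? X m) ⟩
    x + (y + z)    ≈⟨ +-congˡ (+-comm y z) ⟩
    x + (z + y)    ≈⟨ ≈-sym (+-assoc x z y) ⟩
    (x + z) + y    ≈⟨ +-comm _ y ⟩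
    y + (x + z)    ∎
    where
      open Data.Bool using (if_then_else_)
      x = if eqM m′ m then a else 0#
      y = coeff (filter (P? ∘ proj₂) X) m
      z = coeff (filter (¬? ∘ P? ∘ proj₂) X) m

  AgreeUpTo : ℕ → FS → FS → Set r
  AgreeUpTo ℓ s t = ∀ m → len m ≤ ℓ → coeff s m ≈ coeff t m

  AgreeUpTo⇒≈mod : ∀ {ℓ s t} → AgreeUpTo ℓ s t → s ≈⟨mod ℓ ⟩ t
  AgreeUpTo⇒≈mod {ℓ} {s} {t} agree m (s≤s len≤ℓ) = begin
    coeff (s ⊝ t) m          ≈⟨ coeff-⊝ s t m ⟩
    coeff s m + - coeff t m  ≈⟨ +-congʳ (agree m len≤ℓ) ⟩
    coeff t m + - coeff t m  ≈⟨ -‿inverseʳ _ ⟩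
    0#                       ∎

  coeff-long : ∀ {ℓ} X → InSpan (λ m → ℓ < len m) X → ∀ m → len m ≤ ℓ → coeff X m ≈ 0#
  coeff-long []             []            m _   = ≈-refl
  coeff-long ((a , m′) ∷ X) (ℓ<m′ ∷ long) m m≤ℓ with eqM m′ m in eq
  ... | true  = ⊥-elim (<⇒≱ ℓ<m′ (subst (_≤ _) (sym (eqM⇒len≡ m′ m (subst T (sym eq) _))) m≤ℓ))
  ... | false = ≈-trans (+-identityˡ _) (coeff-long X long m m≤ℓ)

  ⊛-InSpan : ∀ {P Q R : M → Set} {a s} → InSpan P a → InSpan Q s →
             (∀ {x y} → P x → Q y → R (x · y)) → InSpan R (a ⊛ s)
  ⊛-InSpan []        _  _ = []
  ⊛-InSpan (px ∷ pa) qs f = ++⁺ (map⁺ (All.map (f px) qs)) (⊛-InSpan pa qs f)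

  truncation : ∀ {Q : M → Set} ℓ X → InSpan (λ m → Q m ⊎ ℓ < len m) X →
               ∃ λ t → InSpan Q t × X ≈⟨mod ℓ ⟩ t
  truncation {Q} ℓ X X-split = short , short-in-Q , AgreeUpTo⇒≈mod {ℓ} {X} {short} agree
    where
      short? : Decidable (λ m → len m ≤ ℓ)
      short? m = len m ≤? ℓ
      short long : FS
      short = filter (short? ∘ proj₂) X
      long  = filter (¬? ∘ short? ∘ proj₂) X
      short-in-Q : InSpan Q short
      short-in-Q = All.zipWith (λ { (inj₁ q , _) → q ; (inj₂ ℓ<m , m≤ℓ) → ⊥-elim (<⇒≱ ℓ<m m≤ℓ) })
                               (filter⁺ (short? ∘ proj₂) X-split , all-filter (short? ∘ proj₂) X)
      long-is-long : InSpan (λ m → ℓ < len m) long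
      long-is-long = All.map ≰⇒> (all-filter (¬? ∘ short? ∘ proj₂) X)
      agree : AgreeUpTo ℓ X short
      agree m m≤ℓ = begin
        coeff X m                     ≈⟨ coeff-filter short? X m ⟩
        coeff short m + coeff long m  ≈⟨ +-congˡ (coeff-long long long-is-long m m≤ℓ) ⟩
        coeff short m + 0#            ≈⟨ +-identityʳ _ ⟩
        coeff short m                 ∎

  basis-⊛-long : ∀ {Q : M → Set} {ℓ g} → (∀ {s} → Q s → ℓ < len (g · s)) →
                 ∀ {s} → InSpan Q s → InSpan (λ m → ℓ < len m) (basis g ⊛ s)
  basis-⊛-long {g = g} long hs = ⊛-InSpan {P = _≡ g} (refl ∷ []) hs λ { refl → long }

  basis-⊛-≈0 : ∀ {Q : M → Set} ℓ {g} → (∀ {s} → Q s → ℓ < len (g · s)) →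
               ∀ s → InSpan Q s → (basis g ⊛ s) ≈⟨mod ℓ ⟩ []
  basis-⊛-≈0 ℓ {g} long s hs =
    AgreeUpTo⇒≈mod {ℓ} {basis g ⊛ s} {[]} (coeff-long (basis g ⊛ s) (basis-⊛-long long hs))

  generatorSum : ∀ {G : Set} → (G → M) → List G → FS
  generatorSum gen gs = map (λ g → 1# , gen g) gs

  generatorSum-⊛-restrict : ∀ {Q : M → Set} ℓ {G : Set} (gen : G → M) (p : G → Bool) gs →
    (∀ {g} → g ∈ gs → ¬ T (p g) → ∀ {s} → Q s → ℓ < len (gen g · s)) →
    ∀ s → InSpan Q s → (generatorSum gen gs ⊛ s) ≈⟨mod ℓ ⟩ (generatorSum gen (filterᵇ p gs) ⊛ s)
  generatorSum-⊛-restrict {Q} ℓ gen p gs long s hs =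
    AgreeUpTo⇒≈mod {ℓ} {generatorSum gen gs ⊛ s} {generatorSum gen (filterᵇ p gs) ⊛ s} (agree gs long)
    where
      agree : ∀ gs → (∀ {g} → g ∈ gs → ¬ T (p g) → ∀ {s} → Q s → ℓ < len (gen g · s)) →
              AgreeUpTo ℓ (generatorSum gen gs ⊛ s) (generatorSum gen (filterᵇ p gs) ⊛ s)
      agree []       _    m _   = ≈-refl
      agree (g ∷ gs) long m m≤ℓ with p g in pg
      ... | true  = begin
        coeff (generatorSum gen (g ∷ gs) ⊛ s) m
          ≈⟨ coeff-⊛-∷ 1# (gen g) (generatorSum gen gs) s m ⟩
        coeff (basis (gen g) ⊛ s) m + coeff (generatorSum gen gs ⊛ s) m
          ≈⟨ +-congˡ (agree gs (long ∘ there) m m≤ℓ) ⟩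
        coeff (basis (gen g) ⊛ s) m + coeff (generatorSum gen (filterᵇ p gs) ⊛ s) m
          ≈⟨ coeff-⊛-∷ 1# (gen g) (generatorSum gen (filterᵇ p gs)) s m ⟨
        coeff (generatorSum gen (g ∷ filterᵇ p gs) ⊛ s) m ∎
      ... | false = begin
        coeff (generatorSum gen (g ∷ gs) ⊛ s) m
          ≈⟨ coeff-⊛-∷ 1# (gen g) (generatorSum gen gs) s m ⟩
        coeff (basis (gen g) ⊛ s) m + coeff (generatorSum gen gs ⊛ s) m
          ≈⟨ +-cong (coeff-long _ (basis-⊛-long (long (here refl) (subst T pg)) hs) m m≤ℓ)
                    (agree gs (long ∘ there) m m≤ℓ) ⟩
        0# + coeff (generatorSum gen (filterᵇ p gs) ⊛ s) m
          ≈⟨ +-identityˡ _ ⟩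
        coeff (generatorSum gen (filterᵇ p gs) ⊛ s) m ∎

-- Words without repetition

module _ {n : ℕ} where

  eqWord⇒≡ : (v w : Word n) → T (eqWord v w) → v ≡ w
  eqWord⇒≡ []      []      _ = refl
  eqWord⇒≡ (x ∷ v) (y ∷ w) t with x ≟ᶠ y
  ... | yes refl = cong (x ∷_) (eqWord⇒≡ v w t)

  eqWord⇒length≡ : (v w : Word n) → T (eqWord v w) → length v ≡ length w
  eqWord⇒length≡ v w = cong length ∘ eqWord⇒≡ v w

  ·W≡deduplicate : (v w : Word n) → v ·W w ≡ deduplicate _≟ᶠ_ (v ++ w)
  ·W≡deduplicate v w = deduplicateᵇ-does _≟ᶠ_ (v ++ w)

  ·W-Unique : (v w : Word n) → Unique (v ·W w)
  ·W-Unique v w rewrite ·W≡deduplicate v w = deduplicate-! _≟ᶠ_ (v ++ w)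

  ∈-·W⁺ʳ : ∀ v {w : Word n} {z} → z ∈ w → z ∈ v ·W w
  ∈-·W⁺ʳ v {w} z∈w rewrite ·W≡deduplicate v w = ∈-deduplicate⁺ _≟ᶠ_ (∈-++⁺ʳ v z∈w)

  InFUW-dichotomy : ∀ {U : Subset n} {ℓ} v {w} → InFUW U ℓ w →
                    InFUW U ℓ (v ·W w) ⊎ ℓ < length (v ·W w)
  InFUW-dichotomy v {w} (!w , refl , w⊆U)
    with all-or-counterexample (λ y → DecMembership._∈?_ _≟ᶠ_ y w) (v ·W w)
  ... | inj₁ vw⊆w = inj₁ (·W-Unique v w , length≡ , All.map (All.lookup w⊆U) vw⊆w)
    where
      length≡ : length (v ·W w) ≡ length w
      length≡ = ≤-antisym (Unique-⊆⇒length≤ (·W-Unique v w) (All.lookup vw⊆w))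
                          (Unique-⊆⇒length≤ !w (∈-·W⁺ʳ v))
  ... | inj₂ (y , y∈vw , y∉w) = inj₂ (Unique-⊆⇒length≤ (y∉w′ ∷ !w) y∷w⊆vw)
    where
      y∉w′ : All (λ z → ¬ y ≡ z) w
      y∉w′ = All.tabulate λ z∈w y≡z → y∉w (subst (_∈ w) (sym y≡z) z∈w)
      y∷w⊆vw : y ∷ w ⊆ v ·W w
      y∷w⊆vw (here refl)  = y∈vw
      y∷w⊆vw (there z∈w) = ∈-·W⁺ʳ v z∈w

  ·W-leaves : ∀ {U : Subset n} {ℓ i} → i ∉ U → ∀ {w} → InFUW U ℓ w → ¬ InFUW U ℓ ((i ∷ []) ·W w)
  ·W-leaves i∉U _ (_ , _ , i∈U ∷ _) = i∉U i∈U

module WordQuotient {c r} (K : Field c r) {n : ℕ} (U : Subset n) (ℓ : ℕ) where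
  open WordAlg K n
  open TruncatedProducts K (eqWord {n}) _·W_ length eqWord⇒length≡

  ⊛-closed : ∀ a s → InSpan IsWord a → InSpan (InFUW U ℓ) s →
             ∃ λ t → InSpan (InFUW U ℓ) t × (a ⊛ s) ≈⟨mod ℓ ⟩ t
  ⊛-closed a s ha hs = truncation ℓ (a ⊛ s) (⊛-InSpan ha hs λ {v} _ → InFUW-dichotomy v)

  ∉⇒⊛-long : ∀ {i} → i ∉ U → ∀ {w} → InFUW U ℓ w → ℓ < length ((i ∷ []) ·W w)
  ∉⇒⊛-long {i} i∉U hw = [ ⊥-elim ∘ ·W-leaves i∉U hw , id ]′ (InFUW-dichotomy (i ∷ []) hw)

  ∉-annihilates : ∀ i → i ∉ U → ∀ s → InSpan (InFUW U ℓ) s → (basis (i ∷ []) ⊛ s) ≈⟨mod ℓ ⟩ []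
  ∉-annihilates i i∉U = basis-⊛-≈0 {InFUW U ℓ} ℓ {i ∷ []} (∉⇒⊛-long i∉U)

  x⊛≈xᵁ⊛ : ∀ s → InSpan (InFUW U ℓ) s → (xW K ⊤ ⊛ s) ≈⟨mod ℓ ⟩ (xW K U ⊛ s)
  x⊛≈xᵁ⊛ s hs = subst (λ is → (generatorSum (_∷ []) is ⊛ s) ≈⟨mod ℓ ⟩ (xW K U ⊛ s))
    (sym filter-⊤)
    (generatorSum-⊛-restrict {InFUW U ℓ} ℓ (_∷ []) (lookup U) (allFin n)
      (λ _ ∉ᵇ → ∉⇒⊛-long λ i∈U → ∉ᵇ (subst T (sym ([]=⇒lookup i∈U)) _)) s hs)
    where
      filter-⊤ : filterᵇ (lookup (⊤ {n})) (allFin n) ≡ allFin n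
      filter-⊤ = filter-all (T? ∘ lookup ⊤) (All.tabulate λ {i} _ → subst T (sym ([]=⇒lookup (∈⊤ {x = i}))) _)

-- Linear algebra over a finite field

module LinearAlgebra (F : FiniteField) (n : ℕ) where
  open FiniteField F
  open Flags F n
  open IsCommutativeRing isCommutativeRing
    using (+-assoc; +-comm; +-identityˡ; *-assoc; *-comm; *-identityˡ;
           distribˡ; distribʳ; zeroˡ; zeroʳ; -‿inverseʳ; isRing)
  private
    ring : Ring 0ℓ 0ℓ
    ring = record { isRing = isRing }
  open RingProperties ring using (-1*x≈-x; -‿involutive)
  open ≡-Reasoning

  -- The operations _+V_, _∙V_, 0V of Defs at every length m (also for coefficient
  -- vectors); at m = n they agree definitionally with those of Defs.
  infixl 6 _+ᵛ_ _-ᵛ_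
  infixr 7 _∙ᵛ_

  _+ᵛ_ : ∀ {m} → Vec Carrier m → Vec Carrier m → Vec Carrier m
  _+ᵛ_ = zipWith _+_

  _∙ᵛ_ : ∀ {m} → Carrier → Vec Carrier m → Vec Carrier m
  a ∙ᵛ v = Vec.map (a *_) v

  _-ᵛ_ : ∀ {m} → Vec Carrier m → Vec Carrier m → Vec Carrier m
  v -ᵛ w = v +ᵛ (- 1#) ∙ᵛ w

  0ᵛ : ∀ {m} → Vec Carrier m
  0ᵛ = replicate _ 0#

  +ᵛ-comm : ∀ {m} (v w : Vec Carrier m) → v +ᵛ w ≡ w +ᵛ v
  +ᵛ-comm []      []      = refl
  +ᵛ-comm (x ∷ v) (y ∷ w) = cong₂ _∷_ (+-comm x y) (+ᵛ-comm v w)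

  +ᵛ-assoc : ∀ {m} (u v w : Vec Carrier m) → (u +ᵛ v) +ᵛ w ≡ u +ᵛ (v +ᵛ w)
  +ᵛ-assoc []      []      []      = refl
  +ᵛ-assoc (x ∷ u) (y ∷ v) (z ∷ w) = cong₂ _∷_ (+-assoc x y z) (+ᵛ-assoc u v w)

  +ᵛ-identityˡ : ∀ {m} (v : Vec Carrier m) → 0ᵛ +ᵛ v ≡ v
  +ᵛ-identityˡ []      = refl
  +ᵛ-identityˡ (x ∷ v) = cong₂ _∷_ (+-identityˡ x) (+ᵛ-identityˡ v)

  +ᵛ-identityʳ : ∀ {m} (v : Vec Carrier m) → v +ᵛ 0ᵛ ≡ v
  +ᵛ-identityʳ v = trans (+ᵛ-comm v 0ᵛ) (+ᵛ-identityˡ v)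

  ∙ᵛ-distribˡ : ∀ {m} a (v w : Vec Carrier m) → a ∙ᵛ (v +ᵛ w) ≡ a ∙ᵛ v +ᵛ a ∙ᵛ w
  ∙ᵛ-distribˡ a []      []      = refl
  ∙ᵛ-distribˡ a (x ∷ v) (y ∷ w) = cong₂ _∷_ (distribˡ a x y) (∙ᵛ-distribˡ a v w)

  ∙ᵛ-distribʳ : ∀ {m} a b (v : Vec Carrier m) → (a + b) ∙ᵛ v ≡ a ∙ᵛ v +ᵛ b ∙ᵛ v
  ∙ᵛ-distribʳ a b []      = refl
  ∙ᵛ-distribʳ a b (x ∷ v) = cong₂ _∷_ (distribʳ x a b) (∙ᵛ-distribʳ a b v)

  ∙ᵛ-assoc : ∀ {m} a b (v : Vec Carrier m) → a ∙ᵛ b ∙ᵛ v ≡ (a * b) ∙ᵛ v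
  ∙ᵛ-assoc a b []      = refl
  ∙ᵛ-assoc a b (x ∷ v) = cong₂ _∷_ (sym (*-assoc a b x)) (∙ᵛ-assoc a b v)

  ∙ᵛ-identityˡ : ∀ {m} (v : Vec Carrier m) → 1# ∙ᵛ v ≡ v
  ∙ᵛ-identityˡ []      = refl
  ∙ᵛ-identityˡ (x ∷ v) = cong₂ _∷_ (*-identityˡ x) (∙ᵛ-identityˡ v)

  ∙ᵛ-zeroˡ : ∀ {m} (v : Vec Carrier m) → 0# ∙ᵛ v ≡ 0ᵛ
  ∙ᵛ-zeroˡ []      = refl
  ∙ᵛ-zeroˡ (x ∷ v) = cong₂ _∷_ (zeroˡ x) (∙ᵛ-zeroˡ v)

  ∙ᵛ-zeroʳ : ∀ {m} a → a ∙ᵛ 0ᵛ {m} ≡ 0ᵛ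
  ∙ᵛ-zeroʳ {zero}  a = refl
  ∙ᵛ-zeroʳ {suc m} a = cong₂ _∷_ (zeroʳ a) (∙ᵛ-zeroʳ a)

  -ᵛ-self : ∀ {m} (v : Vec Carrier m) → v -ᵛ v ≡ 0ᵛ
  -ᵛ-self []      = refl
  -ᵛ-self (x ∷ v) = cong₂ _∷_ (trans (cong (x +_) (-1*x≈-x x)) (-‿inverseʳ x)) (-ᵛ-self v)

  +ᵛ-leftComm : ∀ {m} (u v w : Vec Carrier m) → u +ᵛ (v +ᵛ w) ≡ v +ᵛ (u +ᵛ w)
  +ᵛ-leftComm u v w = begin
    u +ᵛ (v +ᵛ w)  ≡⟨ +ᵛ-assoc u v w ⟨
    (u +ᵛ v) +ᵛ w  ≡⟨ cong (_+ᵛ w) (+ᵛ-comm u v) ⟩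
    (v +ᵛ u) +ᵛ w  ≡⟨ +ᵛ-assoc v u w ⟩
    v +ᵛ (u +ᵛ w)  ∎

  +ᵛ-interchange : ∀ {m} (u v w x : Vec Carrier m) → (u +ᵛ v) +ᵛ (w +ᵛ x) ≡ (u +ᵛ w) +ᵛ (v +ᵛ x)
  +ᵛ-interchange u v w x = begin
    (u +ᵛ v) +ᵛ (w +ᵛ x)  ≡⟨ +ᵛ-assoc u v (w +ᵛ x) ⟩
    u +ᵛ (v +ᵛ (w +ᵛ x))  ≡⟨ cong (u +ᵛ_) (+ᵛ-leftComm v w x) ⟩
    u +ᵛ (w +ᵛ (v +ᵛ x))  ≡⟨ +ᵛ-assoc u w (v +ᵛ x) ⟨
    (u +ᵛ w) +ᵛ (v +ᵛ x)  ∎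

  +ᵛ-minusˡ : ∀ {m} (u v : Vec Carrier m) → (u +ᵛ v) -ᵛ u ≡ v
  +ᵛ-minusˡ u v = begin
    (u +ᵛ v) -ᵛ u  ≡⟨ cong (_-ᵛ u) (+ᵛ-comm u v) ⟩
    (v +ᵛ u) -ᵛ u  ≡⟨ +ᵛ-assoc v u _ ⟩
    v +ᵛ (u -ᵛ u)  ≡⟨ cong (v +ᵛ_) (-ᵛ-self u) ⟩
    v +ᵛ 0ᵛ        ≡⟨ +ᵛ-identityʳ v ⟩
    v              ∎

  +ᵛ-minus-cancel : ∀ {m} (u v : Vec Carrier m) → u +ᵛ (v -ᵛ u) ≡ v
  +ᵛ-minus-cancel u v = trans (sym (+ᵛ-assoc u v _)) (+ᵛ-minusˡ u v)

  +ᵛ≡0ᵛ⇒≡-ᵛ : ∀ {m} (v w : Vec Carrier m) → v +ᵛ w ≡ 0ᵛ → v ≡ (- 1#) ∙ᵛ w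
  +ᵛ≡0ᵛ⇒≡-ᵛ v w v+w≡0 = begin
    v                        ≡⟨ +ᵛ-identityʳ v ⟨
    v +ᵛ 0ᵛ                  ≡⟨ cong (v +ᵛ_) (-ᵛ-self w) ⟨
    v +ᵛ (w -ᵛ w)            ≡⟨ +ᵛ-assoc v w _ ⟨
    (v +ᵛ w) -ᵛ w            ≡⟨ cong (_-ᵛ w) v+w≡0 ⟩
    0ᵛ -ᵛ w                  ≡⟨ +ᵛ-identityˡ _ ⟩
    (- 1#) ∙ᵛ w              ∎

  -ᵛ≡0ᵛ⇒≡ : ∀ {m} (v w : Vec Carrier m) → v -ᵛ w ≡ 0ᵛ → v ≡ w
  -ᵛ≡0ᵛ⇒≡ v w v-w≡0 = begin
    v                        ≡⟨ +ᵛ≡0ᵛ⇒≡-ᵛ v _ v-w≡0 ⟩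
    (- 1#) ∙ᵛ (- 1#) ∙ᵛ w    ≡⟨ ∙ᵛ-assoc _ _ w ⟩
    ((- 1#) * (- 1#)) ∙ᵛ w   ≡⟨ cong (_∙ᵛ w) (trans (-1*x≈-x (- 1#)) (-‿involutive 1#)) ⟩
    1# ∙ᵛ w                  ≡⟨ ∙ᵛ-identityˡ w ⟩
    w                        ∎

  lincomb-+ : ∀ {d} (cs ds : Vec Carrier d) bs → lincomb (cs +ᵛ ds) bs ≡ lincomb cs bs +ᵛ lincomb ds bs
  lincomb-+ []       []       []       = sym (+ᵛ-identityˡ 0ᵛ)
  lincomb-+ (c ∷ cs) (d ∷ ds) (b ∷ bs) = begin
    (c + d) ∙ᵛ b +ᵛ lincomb (cs +ᵛ ds) bs
      ≡⟨ cong₂ _+ᵛ_ (∙ᵛ-distribʳ c d b) (lincomb-+ cs ds bs) ⟩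
    (c ∙ᵛ b +ᵛ d ∙ᵛ b) +ᵛ (lincomb cs bs +ᵛ lincomb ds bs)
      ≡⟨ +ᵛ-interchange _ _ _ _ ⟩
    (c ∙ᵛ b +ᵛ lincomb cs bs) +ᵛ (d ∙ᵛ b +ᵛ lincomb ds bs) ∎

  lincomb-∙ : ∀ {d} a (cs : Vec Carrier d) bs → lincomb (a ∙ᵛ cs) bs ≡ a ∙ᵛ lincomb cs bs
  lincomb-∙ a []       []       = sym (∙ᵛ-zeroʳ a)
  lincomb-∙ a (c ∷ cs) (b ∷ bs) = begin
    (a * c) ∙ᵛ b +ᵛ lincomb (a ∙ᵛ cs) bs  ≡⟨ cong₂ _+ᵛ_ (sym (∙ᵛ-assoc a c b)) (lincomb-∙ a cs bs) ⟩
    a ∙ᵛ c ∙ᵛ b +ᵛ a ∙ᵛ lincomb cs bs     ≡⟨ ∙ᵛ-distribˡ a _ _ ⟨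
    a ∙ᵛ (c ∙ᵛ b +ᵛ lincomb cs bs)        ∎

  Span : ∀ {d} → Vec V d → V → Set
  Span {d} bs v = ∃ λ (cs : Vec Carrier d) → lincomb cs bs ≡ v

  Span-+ : ∀ {d} (bs : Vec V d) {v w} → Span bs v → Span bs w → Span bs (v +ᵛ w)
  Span-+ bs (cs , refl) (ds , refl) = cs +ᵛ ds , lincomb-+ cs ds bs

  Span-∙ : ∀ {d} (bs : Vec V d) a {v} → Span bs v → Span bs (a ∙ᵛ v)
  Span-∙ bs a (cs , refl) = a ∙ᵛ cs , lincomb-∙ a cs bs

  ∈-allVecs : ∀ {m} (v : Vec Carrier m) → v ∈ allVecs m
  ∈-allVecs []      = here refl
  ∈-allVecs (a ∷ v) = ∈-concatMap⁺ _ (Any.map (λ { refl → ∈-map⁺ (a ∷_) (∈-allVecs v) }) (elems-complete a))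

  length-allVecs : ∀ m → length (allVecs m) ≡ order ^ m
  length-allVecs zero    = refl
  length-allVecs (suc m) = trans (length-concat elems) (cong (order Data.Nat.*_) (length-allVecs m))
    where
      length-concat : ∀ as → length (concatMap (λ a → map (a ∷_) (allVecs m)) as) ≡ length as Data.Nat.* length (allVecs m)
      length-concat []       = refl
      length-concat (a ∷ as) =
        trans (length-++ (map (a ∷_) (allVecs m))) (cong₂ Data.Nat._+_ (length-map (a ∷_) (allVecs m)) (length-concat as))

  allVecs-Unique : ∀ m → Unique (allVecs m)
  allVecs-Unique zero    = [] ∷ []
  allVecs-Unique (suc m) = unique elems elems-unique
    where
      head≡ : ∀ {a} {v : Vec Carrier (suc m)} → v ∈ map (a ∷_) (allVecs m) → Vec.head v ≡ a
      head≡ v∈ with ∈-map⁻ _ v∈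
      ... | _ , _ , refl = refl
      unique : ∀ as → Unique as → Unique (concatMap (λ a → map (a ∷_) (allVecs m)) as)
      unique []       _            = []
      unique (a ∷ as) (a∉as ∷ !as) =
        Unique.++⁺ (Unique.map⁺ ∷-injectiveʳ (allVecs-Unique m)) (unique as !as) disjoint
        where
          disjoint : ∀ {v} → v ∈ map (a ∷_) (allVecs m) × v ∈ concatMap (λ a → map (a ∷_) (allVecs m)) as → ⊥
          disjoint (v∈a , v∈as) with find (∈-concatMap⁻ _ {xs = as} v∈as)
          ... | b , b∈as , v∈b = All.lookup a∉as b∈as (trans (sym (head≡ v∈a)) (head≡ v∈b))

  Span? : ∀ {d} (bs : Vec V d) v → Dec (Span bs v)
  Span? {d} bs v with Any.any? (λ cs → ≡-dec _≟_ (lincomb cs bs) v) (allVecs d)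
  ... | yes found = yes (Any.satisfied found)
  ... | no  ¬found = no λ (cs , eq) → ¬found (lose (∈-allVecs cs) eq)

  LinIndep-∷ : ∀ {d} {bs : Vec V d} {v} → LinIndep bs → ¬ Span bs v → LinIndep (v ∷ bs)
  LinIndep-∷ {bs = bs} {v} bs-indep v∉span (c ∷ cs) eq with c ≟ 0#
  ... | yes refl = cong (0# ∷_) (bs-indep cs (trans (sym (+ᵛ-identityˡ _))
                                    (trans (cong (_+ᵛ lincomb cs bs) (sym (∙ᵛ-zeroˡ v))) eq)))
  ... | no  c≢0 with inverse c c≢0
  ...   | c⁻¹ , cc⁻¹≡1 = ⊥-elim (v∉span ((c⁻¹ * - 1#) ∙ᵛ cs , v-in-span))
    where
      v-in-span : lincomb ((c⁻¹ * - 1#) ∙ᵛ cs) bs ≡ v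
      v-in-span = begin
        lincomb ((c⁻¹ * - 1#) ∙ᵛ cs) bs      ≡⟨ lincomb-∙ (c⁻¹ * - 1#) cs bs ⟩
        (c⁻¹ * - 1#) ∙ᵛ lincomb cs bs        ≡⟨ ∙ᵛ-assoc c⁻¹ (- 1#) _ ⟨
        c⁻¹ ∙ᵛ (- 1#) ∙ᵛ lincomb cs bs       ≡⟨ cong (c⁻¹ ∙ᵛ_) (+ᵛ≡0ᵛ⇒≡-ᵛ (c ∙ᵛ v) _ eq) ⟨
        c⁻¹ ∙ᵛ c ∙ᵛ v                        ≡⟨ ∙ᵛ-assoc c⁻¹ c v ⟩
        (c⁻¹ * c) ∙ᵛ v                       ≡⟨ cong (_∙ᵛ v) (trans (*-comm c⁻¹ c) cc⁻¹≡1) ⟩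
        1# ∙ᵛ v                              ≡⟨ ∙ᵛ-identityˡ v ⟩
        v                                    ∎

  lincomb-injective : ∀ {d} {bs : Vec V d} → LinIndep bs → ∀ {cs ds} → lincomb cs bs ≡ lincomb ds bs → cs ≡ ds
  lincomb-injective {bs = bs} bs-indep {cs} {ds} eq = -ᵛ≡0ᵛ⇒≡ cs ds (bs-indep _ (begin
    lincomb (cs -ᵛ ds) bs                        ≡⟨ lincomb-+ cs _ bs ⟩
    lincomb cs bs +ᵛ lincomb ((- 1#) ∙ᵛ ds) bs   ≡⟨ cong₂ _+ᵛ_ eq (lincomb-∙ (- 1#) ds bs) ⟩
    lincomb ds bs -ᵛ lincomb ds bs               ≡⟨ -ᵛ-self _ ⟩
    0ᵛ                                           ∎))

  2≤order : 2 ≤ order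
  2≤order = Unique-⊆⇒length≤ {xs = 0# ∷ 1# ∷ []} ((1≢0 ∘ sym ∷ []) ∷ [] ∷ []) (λ {x} _ → elems-complete x)

  -- Counting: the q^a combinations of `as` are pairwise distinct and all lie
  -- among the q^b combinations of `bs`.
  LinIndep⇒≤ : ∀ {a b} {as : Vec V a} (bs : Vec V b) → LinIndep as →
               (∀ cs → Span bs (lincomb cs as)) → a ≤ b
  LinIndep⇒≤ {a} {b} {as} bs as-indep as⊆bs with a ≤? b
  ... | yes a≤b = a≤b
  ... | no  a≰b = ⊥-elim (<⇒≱ (^-monoʳ-< order 2≤order (≰⇒> a≰b)) qᵃ≤qᵇ)
    where
      combos⊆ : map (λ cs → lincomb cs as) (allVecs a) ⊆ map (λ ds → lincomb ds bs) (allVecs b)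
      combos⊆ v∈ with ∈-map⁻ _ v∈
      ... | cs , _ , refl with as⊆bs cs
      ...   | ds , eq = subst (_∈ _) eq (∈-map⁺ _ (∈-allVecs ds))
      qᵃ≤qᵇ : order ^ a ≤ order ^ b
      qᵃ≤qᵇ = subst₂ _≤_ (trans (length-map _ (allVecs a)) (length-allVecs a))
                         (trans (length-map _ (allVecs b)) (length-allVecs b))
                (Unique-⊆⇒length≤ (Unique.map⁺ (lincomb-injective as-indep) (allVecs-Unique a)) combos⊆)

  LinIndep⇒Span-⊇ : ∀ {a b} {as : Vec V a} {bs : Vec V b} → LinIndep as →
                    (∀ cs → Span bs (lincomb cs as)) → b ≤ a → ∀ {w} → Span bs w → Span as w
  LinIndep⇒Span-⊇ {as = as} {bs} as-indep as⊆bs b≤a {w} w∈bs with Span? as w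
  ... | yes w∈as = w∈as
  ... | no  w∉as = ⊥-elim (<⇒≱ (s≤s b≤a) (LinIndep⇒≤ bs (LinIndep-∷ as-indep w∉as) w∷as⊆bs))
    where
      w∷as⊆bs : ∀ cs → Span bs (lincomb cs (w ∷ as))
      w∷as⊆bs (c ∷ cs) = Span-+ bs (Span-∙ bs c w∈bs) (as⊆bs cs)

  -- eqV of Defs at every length m, so that it can be reasoned about by induction.
  eqVec : ∀ {m} → Vec Carrier m → Vec Carrier m → Bool
  eqVec v w = Vec.foldr (λ _ → Bool) _∧_ true (zipWith (λ a b → does (a ≟ b)) v w)

  eqVec⇒≡ : ∀ {m} (v w : Vec Carrier m) → T (eqVec v w) → v ≡ w
  eqVec⇒≡ []      []      _ = refl
  eqVec⇒≡ (a ∷ v) (b ∷ w) t with a ≟ b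
  ... | yes refl = cong (a ∷_) (eqVec⇒≡ v w t)

  eqVec-refl : ∀ {m} (v : Vec Carrier m) → T (eqVec v v)
  eqVec-refl []      = _
  eqVec-refl (a ∷ v) with a ≟ a
  ... | yes _   = eqVec-refl v
  ... | no  a≢a = a≢a refl

  infix 4 _≐_

  _≐_ : Sub → Sub → Set
  A ≐ B = ∀ v → A v ≡ B v

  ≐-sym : ∀ {A B} → A ≐ B → B ≐ A
  ≐-sym A≐B v = sym (A≐B v)

  ≐-trans : ∀ {A B C} → A ≐ B → B ≐ C → A ≐ C
  ≐-trans A≐B B≐C v = trans (A≐B v) (B≐C v)

  ≐⇒⊆ : ∀ {A B} → A ≐ B → A ⊆S B
  ≐⇒⊆ A≐B v = subst T (A≐B v)

  ⊆S-trans : ∀ {A B C} → A ⊆S B → B ⊆S C → A ⊆S C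
  ⊆S-trans A⊆B B⊆C v = B⊆C v ∘ A⊆B v

  ⊆S-antisym : ∀ {A B} → A ⊆S B → B ⊆S A → A ≐ B
  ⊆S-antisym A⊆B B⊆A v = T-ext (A⊆B v) (B⊆A v)

  eqSub⇒≐ : ∀ A B → T (eqSub A B) → A ≐ B
  eqSub⇒≐ A B t v with A v | B v | All.lookup (all⁺ _ _ t) (∈-allVecs v)
  ... | true  | true  | _ = refl
  ... | false | false | _ = refl

  ≐⇒eqSub : ∀ A B → A ≐ B → T (eqSub A B)
  ≐⇒eqSub A B A≐B with T? (eqSub A B)
  ... | yes t  = t
  ... | no  ¬t with find (¬All⇒Any¬ (λ v → T? _) (allVecs n) (¬t ∘ all⁻ _))
  ...   | v , _ , ¬tᵥ with A v | B v | A≐B v | ¬tᵥ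
  ...     | true  | .true  | refl | ¬t′ = ⊥-elim (¬t′ _)
  ...     | false | .false | refl | ¬t′ = ⊥-elim (¬t′ _)

  ∈zeroSub⇒≡0 : ∀ v → v ∈S zeroSub → v ≡ 0ᵛ
  ∈zeroSub⇒≡0 v = eqVec⇒≡ v 0ᵛ

  0∈zeroSub : 0ᵛ ∈S zeroSub
  0∈zeroSub = eqVec-refl (0ᵛ {n})

  module _ {A : Sub} (A-sub : IsSubspace A) where

    0∈ : 0ᵛ ∈S A
    0∈ = proj₁ A-sub

    +-closed : ∀ {v w} → v ∈S A → w ∈S A → (v +ᵛ w) ∈S A
    +-closed = proj₁ (proj₂ A-sub) _ _

    ∙-closed : ∀ a {v} → v ∈S A → (a ∙ᵛ v) ∈S A
    ∙-closed a = proj₂ (proj₂ A-sub) a _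

    zeroSub⊆ : zeroSub ⊆S A
    zeroSub⊆ v v∈0 = subst (_∈S A) (sym (∈zeroSub⇒≡0 v v∈0)) 0∈

  zeroSub-IsSubspace : IsSubspace zeroSub
  zeroSub-IsSubspace = 0∈zeroSub , sum , scale
    where
      sum : ∀ v w → v ∈S zeroSub → w ∈S zeroSub → (v +ᵛ w) ∈S zeroSub
      sum v w v∈0 w∈0 = subst (_∈S zeroSub)
        (sym (trans (cong₂ _+ᵛ_ (∈zeroSub⇒≡0 v v∈0) (∈zeroSub⇒≡0 w w∈0)) (+ᵛ-identityˡ 0ᵛ))) 0∈zeroSub
      scale : ∀ a v → v ∈S zeroSub → (a ∙ᵛ v) ∈S zeroSub
      scale a v v∈0 = subst (_∈S zeroSub)
        (sym (trans (cong (a ∙ᵛ_) (∈zeroSub⇒≡0 v v∈0)) (∙ᵛ-zeroʳ a))) 0∈zeroSub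

  Dim-zeroSub : Dim zeroSub 0
  Dim-zeroSub = [] , (λ { [] _ → refl }) ,
                λ v → mk⇔ (λ v∈0 → [] , sym (∈zeroSub⇒≡0 v v∈0)) (λ { ([] , refl) → 0∈zeroSub })

  +S-intro : ∀ {A B a b} → a ∈S A → b ∈S B → (a +ᵛ b) ∈S (A +S B)
  +S-intro {A} {B} {a} {b} a∈A b∈B =
    any⁺ _ (lose (∈-allVecs a) (Equivalence.from T-∧ (a∈A , subst (_∈S B) (sym (+ᵛ-minusˡ a b)) b∈B)))

  +S-elim : ∀ {A B x} → x ∈S (A +S B) → ∃ λ a → ∃ λ b → a ∈S A × b ∈S B × x ≡ a +ᵛ b
  +S-elim {A} {B} {x} x∈A+B with find (any⁻ _ (allVecs n) x∈A+B)
  ... | a , _ , t with Equivalence.to T-∧ t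
  ...   | a∈A , x-a∈B = a , x -ᵛ a , a∈A , x-a∈B , sym (+ᵛ-minus-cancel a x)

  +S-IsSubspace : ∀ {A B} → IsSubspace A → IsSubspace B → IsSubspace (A +S B)
  +S-IsSubspace {A} {B} A-sub B-sub = has-0 , sum , scale
    where
      has-0 : 0ᵛ ∈S (A +S B)
      has-0 = subst (_∈S (A +S B)) (+ᵛ-identityˡ 0ᵛ) (+S-intro {A} {B} (0∈ A-sub) (0∈ B-sub))
      sum : ∀ v w → v ∈S (A +S B) → w ∈S (A +S B) → (v +ᵛ w) ∈S (A +S B)
      sum v w v∈ w∈ with +S-elim {A} {B} v∈ | +S-elim {A} {B} w∈
      ... | a , b , a∈ , b∈ , refl | a′ , b′ , a′∈ , b′∈ , refl =
        subst (_∈S (A +S B)) (sym (+ᵛ-interchange a b a′ b′))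
          (+S-intro {A} {B} (+-closed A-sub a∈ a′∈) (+-closed B-sub b∈ b′∈))
      scale : ∀ c v → v ∈S (A +S B) → (c ∙ᵛ v) ∈S (A +S B)
      scale c v v∈ with +S-elim {A} {B} v∈
      ... | a , b , a∈ , b∈ , refl =
        subst (_∈S (A +S B)) (sym (∙ᵛ-distribˡ c a b)) (+S-intro {A} {B} (∙-closed A-sub c a∈) (∙-closed B-sub c b∈))

  +S-monoʳ : ∀ {A B B′} → B ⊆S B′ → (A +S B) ⊆S (A +S B′)
  +S-monoʳ {A} {B} {B′} B⊆B′ x x∈ with +S-elim {A} {B} x∈
  ... | a , b , a∈ , b∈ , refl = +S-intro {A} {B′} a∈ (B⊆B′ b b∈)

  ⊆-+Sˡ : ∀ {A B} → IsSubspace B → A ⊆S (A +S B)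
  ⊆-+Sˡ {A} {B} B-sub x x∈A = subst (_∈S (A +S B)) (+ᵛ-identityʳ x) (+S-intro {A} {B} x∈A (0∈ B-sub))

  ⊆-+Sʳ : ∀ {A B} → IsSubspace A → B ⊆S (A +S B)
  ⊆-+Sʳ {A} {B} A-sub x x∈B = subst (_∈S (A +S B)) (+ᵛ-identityˡ x) (+S-intro {A} {B} (0∈ A-sub) x∈B)

  +S-least : ∀ {A B C} → IsSubspace C → A ⊆S C → B ⊆S C → (A +S B) ⊆S C
  +S-least {A} {B} C-sub A⊆C B⊆C x x∈ with +S-elim {A} {B} x∈
  ... | a , b , a∈ , b∈ , refl = +-closed C-sub (A⊆C a a∈) (B⊆C b b∈)

  +S-zeroSub : ∀ {A} → IsSubspace A → (A +S zeroSub) ≐ A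
  +S-zeroSub {A} A-sub =
    ⊆S-antisym (+S-least {A} {zeroSub} A-sub (λ _ → id) (zeroSub⊆ A-sub)) (⊆-+Sˡ {A} {zeroSub} zeroSub-IsSubspace)

  module _ {A : Sub} {d} (A-dim : Dim A d) where

    basisOf : Vec V d
    basisOf = proj₁ A-dim

    basisOf-LinIndep : LinIndep basisOf
    basisOf-LinIndep = proj₁ (proj₂ A-dim)

    ∈⇒Span : ∀ {v} → v ∈S A → Span basisOf v
    ∈⇒Span = Equivalence.to (proj₂ (proj₂ A-dim) _)

    Span⇒∈ : ∀ {v} → Span basisOf v → v ∈S A
    Span⇒∈ = Equivalence.from (proj₂ (proj₂ A-dim) _)

  ⊆⇒basis-Span : ∀ {A B a b} → A ⊆S B → (A-dim : Dim A a) (B-dim : Dim B b) →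
                 ∀ cs → Span (basisOf B-dim) (lincomb cs (basisOf A-dim))
  ⊆⇒basis-Span A⊆B A-dim B-dim cs = ∈⇒Span B-dim (A⊆B _ (Span⇒∈ A-dim (cs , refl)))

  Dim-mono : ∀ {A B a b} → A ⊆S B → Dim A a → Dim B b → a ≤ b
  Dim-mono A⊆B A-dim B-dim =
    LinIndep⇒≤ (basisOf B-dim) (basisOf-LinIndep A-dim) (⊆⇒basis-Span A⊆B A-dim B-dim)

  Dim-⊆⇒⊇ : ∀ {A B a b} → A ⊆S B → Dim A a → Dim B b → b ≤ a → B ⊆S A
  Dim-⊆⇒⊇ A⊆B A-dim B-dim b≤a v v∈B = Span⇒∈ A-dim
    (LinIndep⇒Span-⊇ (basisOf-LinIndep A-dim) (⊆⇒basis-Span A⊆B A-dim B-dim) b≤a (∈⇒Span B-dim v∈B))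

  Dim-resp-≐ : ∀ {A B d} → A ≐ B → Dim A d → Dim B d
  Dim-resp-≐ A≐B (bs , bs-indep , A⇔span) = bs , bs-indep , λ v →
    mk⇔ (Equivalence.to (A⇔span v) ∘ subst T (sym (A≐B v))) (subst T (A≐B v) ∘ Equivalence.from (A⇔span v))

  Dim-adjoin : ∀ {S X e v} → IsSubspace S → IsSubspace X → S ⊆S X → v ∈S X →
               (∀ {x} → x ∈S X → ∃ λ c → ∃ λ s → s ∈S S × x ≡ c ∙ᵛ v +ᵛ s) →
               Dim S e → Dim X e ⊎ Dim X (suc e)
  Dim-adjoin {S} {X} {e} {v} S-sub X-sub S⊆X v∈X X=⟨v⟩+S S-dim with Span? (basisOf S-dim) v
  ... | yes v∈S = inj₁ (Dim-resp-≐ (⊆S-antisym S⊆X X⊆S) S-dim)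
    where
      X⊆S : X ⊆S S
      X⊆S x x∈X with X=⟨v⟩+S x∈X
      ... | c , s , s∈S , refl = +-closed S-sub (∙-closed S-sub c (Span⇒∈ S-dim v∈S)) s∈S
  ... | no  v∉S = inj₂ (v ∷ basisOf S-dim , LinIndep-∷ (basisOf-LinIndep S-dim) v∉S , λ x → mk⇔ to from)
    where
      to : ∀ {x} → x ∈S X → Span (v ∷ basisOf S-dim) x
      to x∈X with X=⟨v⟩+S x∈X
      ... | c , s , s∈S , refl with ∈⇒Span S-dim s∈S
      ...   | ds , refl = c ∷ ds , refl
      from : ∀ {x} → Span (v ∷ basisOf S-dim) x → x ∈S X
      from (c ∷ ds , refl) = +-closed X-sub (∙-closed X-sub c v∈X) (S⊆X _ (Span⇒∈ S-dim (ds , refl)))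

  codim-one-decomposition : ∀ {Q B j} → IsSubspace B → Q ⊆S B → Dim Q j → Dim B (suc j) →
    ∃ λ v → v ∈S B × (∀ {w} → w ∈S B → ∃ λ c → ∃ λ q → q ∈S Q × w ≡ c ∙ᵛ v +ᵛ q)
  codim-one-decomposition {Q} {B} B-sub Q⊆B Q-dim B-dim
    with all-or-counterexample (λ v → T? (B v) →-dec T? (Q v)) (allVecs n)
  ... | inj₁ B⊆Q = ⊥-elim (<-irrefl refl (Dim-mono (λ v → All.lookup B⊆Q (∈-allVecs v)) B-dim Q-dim))
  ... | inj₂ (v , _ , v∈B∖Q) = v , v∈B , decomposition
    where
      v∈B : v ∈S B
      v∈B with B v
      ... | true  = _
      ... | false = ⊥-elim (v∈B∖Q λ ())
      v∷bsQ-indep : LinIndep (v ∷ basisOf Q-dim)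
      v∷bsQ-indep = LinIndep-∷ (basisOf-LinIndep Q-dim) (λ v∈Q → v∈B∖Q (λ _ → Span⇒∈ Q-dim v∈Q))
      v∷bsQ⊆B : ∀ cs → Span (basisOf B-dim) (lincomb cs (v ∷ basisOf Q-dim))
      v∷bsQ⊆B (c ∷ cs) = ∈⇒Span B-dim (+-closed B-sub (∙-closed B-sub c v∈B) (Q⊆B _ (Span⇒∈ Q-dim (cs , refl))))
      decomposition : ∀ {w} → w ∈S B → ∃ λ c → ∃ λ q → q ∈S Q × w ≡ c ∙ᵛ v +ᵛ q
      decomposition w∈B with LinIndep⇒Span-⊇ v∷bsQ-indep v∷bsQ⊆B ≤-refl (∈⇒Span B-dim w∈B)
      ... | c ∷ cs , refl = c , lincomb cs (basisOf Q-dim) , Span⇒∈ Q-dim (cs , refl) , refl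

  Dim-+S-step : ∀ {A Q B j e} → IsSubspace A → IsSubspace Q → IsSubspace B → Q ⊆S B →
                Dim Q j → Dim B (suc j) → Dim (A +S Q) e → Dim (A +S B) e ⊎ Dim (A +S B) (suc e)
  Dim-+S-step {A} {Q} {B} A-sub Q-sub B-sub Q⊆B Q-dim B-dim
    with codim-one-decomposition B-sub Q⊆B Q-dim B-dim
  ... | v , v∈B , B=⟨v⟩+Q = Dim-adjoin (+S-IsSubspace A-sub Q-sub) (+S-IsSubspace A-sub B-sub)
          (+S-monoʳ {A} {Q} {B} Q⊆B) (⊆-+Sʳ {A} {B} A-sub v v∈B) A+B=⟨v⟩+A+Q
    where
      A+B=⟨v⟩+A+Q : ∀ {x} → x ∈S (A +S B) → ∃ λ c → ∃ λ s → s ∈S (A +S Q) × x ≡ c ∙ᵛ v +ᵛ s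
      A+B=⟨v⟩+A+Q x∈ with +S-elim {A} {B} x∈
      ... | a , b , a∈A , b∈B , refl with B=⟨v⟩+Q b∈B
      ...   | c , q , q∈Q , refl = c , a +ᵛ q , +S-intro {A} {Q} a∈A q∈Q , +ᵛ-leftComm a _ q

-- Products of flags

module FlagProducts (F : FiniteField) (n : ℕ) where
  open Flags F n
  open LinearAlgebra F n
  open import Data.Nat using (_+_)
  open import Data.Nat.Properties using (+-identityʳ; +-suc; m≤m+n)

  eqFlag⇒length≡ : (As Bs : Flag) → T (eqFlag As Bs) → length As ≡ length Bs
  eqFlag⇒length≡ []       []       _ = refl
  eqFlag⇒length≡ (A ∷ As) (B ∷ Bs) t = cong suc (eqFlag⇒length≡ As Bs (proj₂ (Equivalence.to T-∧ t)))

  data Chain (P : Sub) (d : ℕ) : Flag → Set where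
    []   : Chain P d []
    stay : ∀ {Y Ys} → P ⊆S Y → Dim Y d → Chain Y d Ys → Chain P d (Y ∷ Ys)
    grow : ∀ {Y Ys} → IsSubspace Y → P ⊆S Y → Dim Y (suc d) → Chain Y (suc d) Ys → Chain P d (Y ∷ Ys)

  lastFrom : Sub → Flag → Sub
  lastFrom P []       = P
  lastFrom P (A ∷ As) = lastFrom A As

  lastSub≡lastFrom : ∀ As → lastSub As ≡ lastFrom zeroSub As
  lastSub≡lastFrom []       = refl
  lastSub≡lastFrom (A ∷ As) = go A As
    where
      go : ∀ A As → lastSub (A ∷ As) ≡ lastFrom A As
      go A []       = refl
      go A (B ∷ As) = go B As

  lastFrom-++ : ∀ P As Ys → lastFrom P (As ++ Ys) ≡ lastFrom (lastFrom P As) Ys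
  lastFrom-++ P []       Ys = refl
  lastFrom-++ P (A ∷ As) Ys = lastFrom-++ A As Ys

  lastFrom-map : ∀ P f B Bs → lastFrom P (map f (B ∷ Bs)) ≡ f (lastFrom B Bs)
  lastFrom-map P f B []       = refl
  lastFrom-map P f B (C ∷ Bs) = lastFrom-map (f B) f C Bs

  lastFrom-∈ : ∀ B Bs → lastFrom B Bs ∈ B ∷ Bs
  lastFrom-∈ B []       = here refl
  lastFrom-∈ B (C ∷ Bs) = there (lastFrom-∈ C Bs)

  FlagFrom-last : ∀ {P d} As → IsSubspace P → Dim P d → FlagFrom P d As →
                  IsSubspace (lastFrom P As) × Dim (lastFrom P As) (d + length As)
  FlagFrom-last {P} {d} []       P-sub P-dim _ = P-sub , subst (Dim P) (sym (+-identityʳ d)) P-dim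
  FlagFrom-last {P} {d} (A ∷ As) _     _     (A-sub , A-dim , _ , As-flag) with FlagFrom-last As A-sub A-dim As-flag
  ... | last-sub , last-dim = last-sub , subst (Dim (lastFrom A As)) (sym (+-suc d (length As))) last-dim

  lastSub-IsSubspace : ∀ {As} → IsFlag As → IsSubspace (lastSub As)
  lastSub-IsSubspace {As} As-flag = subst IsSubspace (sym (lastSub≡lastFrom As))
    (proj₁ (FlagFrom-last As zeroSub-IsSubspace Dim-zeroSub As-flag))

  lastSub-Dim : ∀ {As} → IsFlag As → Dim (lastSub As) (length As)
  lastSub-Dim {As} As-flag = subst (λ A → Dim A (length As)) (sym (lastSub≡lastFrom As))
    (proj₂ (FlagFrom-last As zeroSub-IsSubspace Dim-zeroSub As-flag))

  FlagFrom-dim≤ : ∀ {P d} As → FlagFrom P d As → ∀ {Y} → Y ∈ As → ∃ λ e → Dim Y e × e ≤ d + length As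
  FlagFrom-dim≤ {d = d} (A ∷ As) (_ , A-dim , _ , _) (here refl) =
    suc d , A-dim , subst (suc d ≤_) (sym (+-suc d (length As))) (s≤s (m≤m+n d (length As)))
  FlagFrom-dim≤ {d = d} (A ∷ As) (_ , _ , _ , As-flag) (there Y∈As) with FlagFrom-dim≤ As As-flag Y∈As
  ... | e , Y-dim , e≤ = e , Y-dim , subst (e ≤_) (sym (+-suc d (length As))) e≤

  FlagFrom-++-Chain : ∀ {P d} As {Ys} → FlagFrom P d As → Chain (lastFrom P As) (d + length As) Ys →
                      Chain P d (As ++ Ys)
  FlagFrom-++-Chain {P} {d} [] {Ys} _ chain = subst (λ k → Chain P k Ys) (+-identityʳ d) chain
  FlagFrom-++-Chain {P} {d} (A ∷ As) {Ys} (A-sub , A-dim , P⊆A , As-flag) chain =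
    grow A-sub P⊆A A-dim (FlagFrom-++-Chain As As-flag (subst (λ k → Chain (lastFrom A As) k Ys) (+-suc d (length As)) chain))

  +S-Chain : ∀ {A Q P j e} Bs → IsSubspace A → IsSubspace Q → Dim Q j → Dim (A +S Q) e → P ⊆S (A +S Q) →
             FlagFrom Q j Bs → Chain P e (map (A +S_) Bs)
  +S-Chain []       _     _     _     _       _     _ = []
  +S-Chain {A} {Q} (B ∷ Bs) A-sub Q-sub Q-dim A+Q-dim P⊆A+Q (B-sub , B-dim , Q⊆B , Bs-flag)
    with Dim-+S-step A-sub Q-sub B-sub Q⊆B Q-dim B-dim A+Q-dim
  ... | inj₁ A+B-dim = stay P⊆A+B A+B-dim (+S-Chain Bs A-sub B-sub B-dim A+B-dim (λ _ → id) Bs-flag)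
    where P⊆A+B = ⊆S-trans P⊆A+Q (+S-monoʳ {A} {Q} {B} Q⊆B)
  ... | inj₂ A+B-dim = grow (+S-IsSubspace A-sub B-sub) P⊆A+B A+B-dim
                            (+S-Chain Bs A-sub B-sub B-dim A+B-dim (λ _ → id) Bs-flag)
    where P⊆A+B = ⊆S-trans P⊆A+Q (+S-monoʳ {A} {Q} {B} Q⊆B)

  rawProduct : Flag → Flag → Flag
  rawProduct As Bs = As ++ map (lastSub As +S_) Bs

  rawProduct-Chain : ∀ As Bs → IsFlag As → IsFlag Bs → Chain zeroSub 0 (rawProduct As Bs)
  rawProduct-Chain As Bs As-flag Bs-flag = FlagFrom-++-Chain As As-flag
    (subst (λ A → Chain A (length As) (map (lastSub As +S_) Bs)) (lastSub≡lastFrom As)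
      (+S-Chain Bs A-sub zeroSub-IsSubspace Dim-zeroSub
                (Dim-resp-≐ (≐-sym A+0≐A) (lastSub-Dim As-flag)) (≐⇒⊆ (≐-sym A+0≐A)) Bs-flag))
    where
      A-sub = lastSub-IsSubspace As-flag
      A+0≐A = +S-zeroSub A-sub

  Chain-⊇ : ∀ {P d X} → Chain P d X → ∀ {Z} → Z ∈ X → P ⊆S Z
  Chain-⊇ (stay P⊆Y _ _)   (here refl) = P⊆Y
  Chain-⊇ (grow _ P⊆Y _ _) (here refl) = P⊆Y
  Chain-⊇ (stay P⊆Y _ c)   (there Z∈)  = ⊆S-trans P⊆Y (Chain-⊇ c Z∈)
  Chain-⊇ (grow _ P⊆Y _ c) (there Z∈)  = ⊆S-trans P⊆Y (Chain-⊇ c Z∈)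

  Chain-head-⊆ : ∀ {P d Y X} → Chain P d (Y ∷ X) → ∀ {Z} → Z ∈ Y ∷ X → Y ⊆S Z
  Chain-head-⊆ _              (here refl) _ = id
  Chain-head-⊆ (stay _ _ c)   (there Z∈)    = Chain-⊇ c Z∈
  Chain-head-⊆ (grow _ _ _ c) (there Z∈)    = Chain-⊇ c Z∈

  Chain-⊆-last : ∀ {P d X} → Chain P d X → ∀ {Z} → Z ∈ X → Z ⊆S lastFrom P X
  Chain-⊆-last {X = Y ∷ X} c (here refl) = Chain-head-⊆ c (lastFrom-∈ Y X)
  Chain-⊆-last (stay _ _ c)   (there Z∈) = Chain-⊆-last c Z∈
  Chain-⊆-last (grow _ _ _ c) (there Z∈) = Chain-⊆-last c Z∈

  nub : Flag → Flag
  nub = deduplicateᵇ eqSub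

  without : Sub → Flag → Flag
  without P = filter (λ Z → ¬? (T? (eqSub P Z)))

  ∈-nub⁻ : ∀ {X Z} → Z ∈ nub X → Z ∈ X
  ∈-nub⁻ {X} = ∈-deduplicate⁻ (T? ∘₂ eqSub) X

  nub-covers : ∀ {X Z} → Z ∈ X → ∃ λ Y → Y ∈ nub X × Y ≐ Z
  nub-covers {X} {Z} Z∈X = find (deduplicate⁺ (T? ∘₂ eqSub) resp (Any.map (λ { refl _ → refl }) Z∈X))
    where
      resp : ∀ {Y Y′} → T (eqSub Y′ Y) → Y ≐ Z → Y′ ≐ Z
      resp t Y≐Z = ≐-trans (eqSub⇒≐ _ _ t) Y≐Z

  ∈-without⁻ : ∀ {P L Z} → Z ∈ without P L → Z ∈ L × ¬ T (eqSub P Z)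
  ∈-without⁻ {P} {L} = ∈-filter⁻ (λ Z → ¬? (T? (eqSub P Z))) {xs = L}

  without-id : ∀ {P L} → (∀ {Z} → Z ∈ L → ¬ P ≐ Z) → without P L ≡ L
  without-id {P} {L} P∉L = filter-all (λ Z → ¬? (T? (eqSub P Z))) (All.tabulate λ Z∈L → P∉L Z∈L ∘ eqSub⇒≐ P _)

  FlagFrom-resp-≐ : ∀ {P P′ d} L → P ≐ P′ → FlagFrom P d L → FlagFrom P′ d L
  FlagFrom-resp-≐ []      _    _                      = _
  FlagFrom-resp-≐ (_ ∷ _) P≐P′ (A-sub , A-dim , P⊆A , L-flag) =
    A-sub , A-dim , ⊆S-trans (≐⇒⊆ (≐-sym P≐P′)) P⊆A , L-flag

  -- nub (P ∷ X) reduces to P ∷ without P (nub X).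
  Chain⇒FlagFrom : ∀ {P d X} → Dim P d → Chain P d X → FlagFrom P d (without P (nub X))
  Chain⇒FlagFrom _ [] = _
  Chain⇒FlagFrom {P} {d} P-dim (stay {Y} {Ys} P⊆Y Y-dim c) with eqSub P Y in P=Y
  ... | false = ⊥-elim (subst T P=Y (≐⇒eqSub P Y (⊆S-antisym P⊆Y (Dim-⊆⇒⊇ P⊆Y P-dim Y-dim ≤-refl))))
  ... | true  = FlagFrom-resp-≐ _ (≐-sym P≐Y) (subst (FlagFrom Y d) (sym (without-id P∉)) (Chain⇒FlagFrom Y-dim c))
    where
      P≐Y : P ≐ Y
      P≐Y = eqSub⇒≐ P Y (subst T (sym P=Y) _)
      P∉ : ∀ {Z} → Z ∈ without Y (nub Ys) → ¬ P ≐ Z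
      P∉ Z∈ P≐Z = proj₂ (∈-without⁻ {Y} {nub Ys} Z∈) (≐⇒eqSub Y _ (≐-trans (≐-sym P≐Y) P≐Z))
  Chain⇒FlagFrom {P} {d} P-dim (grow {Y} {Ys} Y-sub P⊆Y Y-dim c) with eqSub P Y in P=Y
  ... | true  = ⊥-elim (<-irrefl refl (Dim-mono (≐⇒⊆ (≐-sym (eqSub⇒≐ P Y (subst T (sym P=Y) _)))) Y-dim P-dim))
  ... | false = Y-sub , Y-dim , P⊆Y , subst (FlagFrom Y (suc d)) (sym (without-id P∉)) (Chain⇒FlagFrom Y-dim c)
    where
      P∉ : ∀ {Z} → Z ∈ without Y (nub Ys) → ¬ P ≐ Z
      P∉ Z∈ P≐Z = <-irrefl refl (Dim-mono (⊆S-trans Y⊆Z (≐⇒⊆ (≐-sym P≐Z))) Y-dim P-dim)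
        where Y⊆Z = Chain-⊇ c (∈-nub⁻ {Ys} (proj₁ (∈-without⁻ {Y} {nub Ys} Z∈)))

  Dim1⇒⊈zeroSub : ∀ {A} → Dim A 1 → ¬ A ⊆S zeroSub
  Dim1⇒⊈zeroSub A-dim A⊆0 with Dim-mono A⊆0 A-dim Dim-zeroSub
  ... | ()

  Chain⇒IsFlag : ∀ {Y X} → Chain zeroSub 0 (Y ∷ X) → ¬ Y ⊆S zeroSub → IsFlag (nub (Y ∷ X))
  Chain⇒IsFlag {Y} {X} c Y⊈0 = subst IsFlag (without-id 0∉) (Chain⇒FlagFrom Dim-zeroSub c)
    where
      0∉ : ∀ {Z} → Z ∈ nub (Y ∷ X) → ¬ zeroSub ≐ Z
      0∉ Z∈ 0≐Z = Y⊈0 (⊆S-trans (Chain-head-⊆ c (∈-nub⁻ {Y ∷ X} Z∈)) (≐⇒⊆ (≐-sym 0≐Z)))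

  ·F-IsFlag : ∀ As Bs → IsFlag As → IsFlag Bs → IsFlag (As ·F Bs)
  ·F-IsFlag []       []       _ _ = _
  ·F-IsFlag (A ∷ As) Bs       As-flag@(_ , A-dim , _) Bs-flag =
    Chain⇒IsFlag (rawProduct-Chain (A ∷ As) Bs As-flag Bs-flag) (Dim1⇒⊈zeroSub A-dim)
  ·F-IsFlag []       (B ∷ Bs) _ Bs-flag@(_ , B-dim , _) =
    Chain⇒IsFlag (rawProduct-Chain [] (B ∷ Bs) _ Bs-flag)
                 (Dim1⇒⊈zeroSub B-dim ∘ ⊆S-trans (⊆-+Sʳ {zeroSub} {B} zeroSub-IsSubspace))

  ·F-⊆-top : ∀ {As B Bs} → IsFlag As → IsFlag (B ∷ Bs) →
             ∀ {Z} → Z ∈ As ·F (B ∷ Bs) → Z ⊆S (lastSub As +S lastFrom B Bs)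
  ·F-⊆-top {As} {B} {Bs} As-flag Bs-flag Z∈ =
    subst (_ ⊆S_) chain-last (Chain-⊆-last (rawProduct-Chain As (B ∷ Bs) As-flag Bs-flag) (∈-nub⁻ Z∈))
    where
      chain-last : lastFrom zeroSub (rawProduct As (B ∷ Bs)) ≡ lastSub As +S lastFrom B Bs
      chain-last = trans (lastFrom-++ zeroSub As _) (lastFrom-map (lastFrom zeroSub As) (lastSub As +S_) B Bs)

  ·F-top-dim≤ : ∀ {As B Bs} → IsFlag As → IsFlag (B ∷ Bs) →
                ∃ λ e → Dim (lastSub As +S lastFrom B Bs) e × e ≤ length (As ·F (B ∷ Bs))
  ·F-top-dim≤ {As} {B} {Bs} As-flag Bs-flag
    with nub-covers {rawProduct As (B ∷ Bs)} (∈-++⁺ʳ As (∈-map⁺ (lastSub As +S_) (lastFrom-∈ B Bs)))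
  ... | Y , Y∈ , Y≐top with FlagFrom-dim≤ (As ·F (B ∷ Bs)) (·F-IsFlag As (B ∷ Bs) As-flag Bs-flag) Y∈
  ...   | e , Y-dim , e≤p = e , Dim-resp-≐ Y≐top Y-dim , e≤p

  InFU-dichotomy : ∀ {U ℓ} As {Bs} → IsFlag As → InFU U ℓ Bs → InFU U ℓ (As ·F Bs) ⊎ ℓ < length (As ·F Bs)
  InFU-dichotomy As {[]} As-flag (Bs-flag , refl , _) with As ·F [] | ·F-IsFlag As [] As-flag Bs-flag
  ... | []    | flag = inj₁ (flag , refl , [])
  ... | _ ∷ _ | _    = inj₂ (s≤s z≤n)
  InFU-dichotomy As {B ∷ Bs} As-flag (Bs-flag , refl , Bs⊆U) with length (B ∷ Bs) <? length (As ·F (B ∷ Bs))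
  ... | yes ℓ<p = inj₂ ℓ<p
  ... | no  ℓ≮p with ·F-top-dim≤ As-flag Bs-flag
  ...   | e , top-dim , e≤p =
    inj₁ (·F-IsFlag As (B ∷ Bs) As-flag Bs-flag , ≤-antisym p≤ℓ (≤-trans ℓ≤e e≤p) ,
          All.tabulate λ Z∈ → ⊆S-trans (·F-⊆-top As-flag Bs-flag Z∈) (⊆S-trans top⊆Bℓ Bℓ⊆U))
    where
      p≤ℓ = ≮⇒≥ ℓ≮p
      Bℓ-dim : Dim (lastFrom B Bs) (length (B ∷ Bs))
      Bℓ-dim = proj₂ (FlagFrom-last (B ∷ Bs) zeroSub-IsSubspace Dim-zeroSub Bs-flag)
      Bℓ⊆top : lastFrom B Bs ⊆S (lastSub As +S lastFrom B Bs)
      Bℓ⊆top = ⊆-+Sʳ {lastSub As} {lastFrom B Bs} (lastSub-IsSubspace As-flag)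
      ℓ≤e = Dim-mono Bℓ⊆top Bℓ-dim top-dim
      top⊆Bℓ = Dim-⊆⇒⊇ Bℓ⊆top Bℓ-dim top-dim (≤-trans e≤p p≤ℓ)
      Bℓ⊆U = All.lookup Bs⊆U (lastFrom-∈ B Bs)

-- Lines

module Lines (F : FiniteField) (n : ℕ) where
  open FiniteField F
  open Flags F n
  open LinearAlgebra F n
  open ≡-Reasoning

  span1⁻ : ∀ v w → w ∈S span1 v → ∃ λ a → a ∙ᵛ v ≡ w
  span1⁻ v w w∈ with find (any⁻ _ elems w∈)
  ... | a , _ , eq = a , eqVec⇒≡ _ _ eq

  span1⁺ : ∀ v a → (a ∙ᵛ v) ∈S span1 v
  span1⁺ v a = any⁺ _ (lose (elems-complete a) (eqVec-refl (a ∙ᵛ v)))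

  span1-IsSubspace : ∀ v → IsSubspace (span1 v)
  span1-IsSubspace v = subst (_∈S span1 v) (∙ᵛ-zeroˡ v) (span1⁺ v 0#) , sum , scale
    where
      sum : ∀ x y → x ∈S span1 v → y ∈S span1 v → (x +ᵛ y) ∈S span1 v
      sum x y x∈ y∈ with span1⁻ v x x∈ | span1⁻ v y y∈
      ... | a , refl | b , refl = subst (_∈S span1 v) (∙ᵛ-distribʳ a b v) (span1⁺ v (a + b))
      scale : ∀ c x → x ∈S span1 v → (c ∙ᵛ x) ∈S span1 v
      scale c x x∈ with span1⁻ v x x∈
      ... | a , refl = subst (_∈S span1 v) (sym (∙ᵛ-assoc c a v)) (span1⁺ v (c * a))

  span1-Dim : ∀ {v} → ¬ v ≡ 0ᵛ → Dim (span1 v) 1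
  span1-Dim {v} v≢0 = v ∷ [] , LinIndep-∷ (λ { [] _ → refl }) (λ { ([] , eq) → v≢0 (sym eq) }) ,
    λ w → mk⇔ (λ w∈ → let a , eq = span1⁻ v w w∈ in a ∷ [] , trans (+ᵛ-identityʳ _) eq)
              (λ { (a ∷ [] , refl) → subst (_∈S span1 v) (sym (+ᵛ-identityʳ _)) (span1⁺ v a) })

  isNonzero : V → Bool
  isNonzero v = not (eqV v 0V)

  isNonzero⇒≢0 : ∀ {v} → T (isNonzero v) → ¬ v ≡ 0ᵛ
  isNonzero⇒≢0 t refl with eqV 0V 0V | eqVec-refl (0ᵛ {n})
  ... | true | _ = t

  linesIn-IsLine : ∀ {L} → L ∈ linesIn fullSpace → IsLine L
  linesIn-IsLine L∈ with ∈-map⁻ span1 (∈-deduplicate⁻ (T? ∘₂ eqSub) _ L∈)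
  ... | v , v∈ , refl = span1-IsSubspace v , span1-Dim (isNonzero⇒≢0 {v} (proj₂ (∈-filter⁻ (T? ∘ isNonzero) {xs = allVecs n} v∈)))

  _⊆ᵇ_ : Sub → Sub → Bool
  L ⊆ᵇ U = all (λ w → not (L w) ∨ U w) (allVecs n)

  private
    impliesᵇ⁻ : ∀ {x y} → T (not x ∨ y) → T x → T y
    impliesᵇ⁻ {true} {true} _ _ = _

    impliesᵇ⁺ : ∀ {x y} → (T x → T y) → T (not x ∨ y)
    impliesᵇ⁺ {false} _   = _
    impliesᵇ⁺ {true}  x⇒y = x⇒y _

  ⊆ᵇ⇒⊆S : ∀ {L U} → T (L ⊆ᵇ U) → L ⊆S U
  ⊆ᵇ⇒⊆S {L} {U} t w = impliesᵇ⁻ {L w} {U w} (All.lookup (all⁺ _ _ t) (∈-allVecs w))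

  ⊆S⇒⊆ᵇ : ∀ {L U} → L ⊆S U → T (L ⊆ᵇ U)
  ⊆S⇒⊆ᵇ {L} {U} L⊆U = all⁻ _ {xs = allVecs n} (All.tabulate λ {w} _ → impliesᵇ⁺ {L w} {U w} (L⊆U w))

  ⊆ᵇ-resp-≐ : ∀ {U L L′} → T (eqSub L L′) → L ⊆ᵇ U ≡ L′ ⊆ᵇ U
  ⊆ᵇ-resp-≐ {U} {L} {L′} t = T-ext (λ L⊆U → ⊆S⇒⊆ᵇ {L′} {U} (⊆S-trans (≐⇒⊆ (≐-sym L≐L′)) (⊆ᵇ⇒⊆S L⊆U)))
                                   (λ L′⊆U → ⊆S⇒⊆ᵇ {L} {U} (⊆S-trans (≐⇒⊆ L≐L′) (⊆ᵇ⇒⊆S L′⊆U)))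
    where L≐L′ = eqSub⇒≐ L L′ t

  span1-⊆ᵇ : ∀ {U} → IsSubspace U → ∀ v → span1 v ⊆ᵇ U ≡ U v
  span1-⊆ᵇ {U} U-sub v = T-ext (λ t → subst (_∈S U) (∙ᵛ-identityˡ v) (⊆ᵇ⇒⊆S {span1 v} {U} t _ (span1⁺ v 1#)))
                               (λ v∈U → ⊆S⇒⊆ᵇ {span1 v} {U} λ w w∈ → let a , eq = span1⁻ v w w∈ in
                                          subst (_∈S U) eq (∙-closed U-sub a v∈U))

  linesIn-filter : ∀ {U} → IsSubspace U → linesIn U ≡ filterᵇ (_⊆ᵇ U) (linesIn fullSpace)
  linesIn-filter {U} U-sub = sym (begin
      filterᵇ (_⊆ᵇ U) (deduplicateᵇ eqSub (map span1 (filterᵇ isNonzero (allVecs n))))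
    ≡⟨ filterᵇ-deduplicateᵇ (_⊆ᵇ U) eqSub (⊆ᵇ-resp-≐ {U}) (map span1 (filterᵇ isNonzero (allVecs n))) ⟩
      deduplicateᵇ eqSub (filterᵇ (_⊆ᵇ U) (map span1 (filterᵇ isNonzero (allVecs n))))
    ≡⟨ cong (deduplicateᵇ eqSub) (filterᵇ-map (_⊆ᵇ U) span1 (filterᵇ isNonzero (allVecs n))) ⟩
      deduplicateᵇ eqSub (map span1 (filterᵇ (λ v → span1 v ⊆ᵇ U) (filterᵇ isNonzero (allVecs n))))
    ≡⟨ cong (deduplicateᵇ eqSub ∘ map span1) (filterᵇ-filterᵇ _ isNonzero (λ v → U v ∧ isNonzero v) U∧≡ (allVecs n)) ⟩
      linesIn U ∎)
    where
      U∧≡ : ∀ v → (U v ∧ isNonzero v) ≡ (isNonzero v ∧ span1 v ⊆ᵇ U)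
      U∧≡ v with isNonzero v
      ... | true  = trans (∧-identityʳ (U v)) (sym (span1-⊆ᵇ U-sub v))
      ... | false = ∧-zeroʳ (U v)

module FlagQuotient {c r} (K : Field c r) (F : FiniteField) (n : ℕ)
                    (U : Flags.Sub F n) (U-sub : Flags.IsSubspace F n U) (ℓ : ℕ) where
  open FlagAlg K F n
  open LinearAlgebra F n using (zeroSub⊆)
  open FlagProducts F n using (eqFlag⇒length≡; InFU-dichotomy)
  open Lines F n
  open TruncatedProducts K eqFlag _·F_ length eqFlag⇒length≡

  ⊛-closed : ∀ a s → InSpan IsFlag a → InSpan (InFU U ℓ) s →
             ∃ λ t → InSpan (InFU U ℓ) t × (a ⊛ s) ≈⟨mod ℓ ⟩ t
  ⊛-closed a s ha hs = truncation ℓ (a ⊛ s) (⊛-InSpan ha hs λ {As} → InFU-dichotomy As)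

  ⊈⇒⊛-long : ∀ {L} → IsLine L → ¬ L ⊆S U → ∀ {Bs} → InFU U ℓ Bs → ℓ < length ((L ∷ []) ·F Bs)
  ⊈⇒⊛-long {L} (L-sub , L-dim) L⊈U hB =
    [ (λ { (_ , _ , L⊆U ∷ _) → ⊥-elim (L⊈U L⊆U) }) , id ]′
      (InFU-dichotomy (L ∷ []) (L-sub , L-dim , zeroSub⊆ L-sub , _) hB)

  ⊈-annihilates : ∀ L → IsLine L → ¬ L ⊆S U → ∀ s → InSpan (InFU U ℓ) s → (basis (L ∷ []) ⊛ s) ≈⟨mod ℓ ⟩ []
  ⊈-annihilates L L-line L⊈U = basis-⊛-≈0 {InFU U ℓ} ℓ {L ∷ []} (⊈⇒⊛-long L-line L⊈U)

  x⊛≈xᵁ⊛ : ∀ s → InSpan (InFU U ℓ) s → (xF fullSpace ⊛ s) ≈⟨mod ℓ ⟩ (xF U ⊛ s)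
  x⊛≈xᵁ⊛ s hs = subst (λ Ls → (xF fullSpace ⊛ s) ≈⟨mod ℓ ⟩ (generatorSum (_∷ []) Ls ⊛ s))
    (sym (linesIn-filter U-sub))
    (generatorSum-⊛-restrict {InFU U ℓ} ℓ (_∷ []) (_⊆ᵇ U) (linesIn fullSpace)
      (λ L∈ ⊈ᵇ → ⊈⇒⊛-long (linesIn-IsLine L∈) (⊈ᵇ ∘ ⊆S⇒⊆ᵇ)) s hs)

proposition4p10 : ∀ {c r} (K : Field c r) →
    (∀ (n ℓ : ℕ) → ℓ ≤ n → InvertibleIn K (n !) →
      (U : Subset n) → ∣ U ∣ ≡ ℓ →
      let open WordAlg K n in
        (∀ a s → InSpan IsWord a → InSpan (InFUW U ℓ) s →
           ∃ λ t → InSpan (InFUW U ℓ) t × (a ⊛ s) ≈⟨mod ℓ ⟩ t)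
      × (∀ i → i ∉ U → ∀ s → InSpan (InFUW U ℓ) s →
           (basis (i ∷ []) ⊛ s) ≈⟨mod ℓ ⟩ [])
      × (∀ s → InSpan (InFUW U ℓ) s →
           (xW K ⊤ ⊛ s) ≈⟨mod ℓ ⟩ (xW K U ⊛ s)))
  ×
    (∀ (F : FiniteField) (n ℓ : ℕ) → ℓ ≤ n →
      let open FlagAlg K F n in
      InvertibleIn K orderGL →
      (U : Sub) → IsSubspace U → Dim U ℓ →
        (∀ a s → InSpan IsFlag a → InSpan (InFU U ℓ) s →
           ∃ λ t → InSpan (InFU U ℓ) t × (a ⊛ s) ≈⟨mod ℓ ⟩ t)
      × (∀ L → IsLine L → ¬ (L ⊆S U) → ∀ s → InSpan (InFU U ℓ) s →
           (basis (L ∷ []) ⊛ s) ≈⟨mod ℓ ⟩ [])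
      × (∀ s → InSpan (InFU U ℓ) s →
           (xF fullSpace ⊛ s) ≈⟨mod ℓ ⟩ (xF U ⊛ s)))
proposition4p10 K =
  (λ n ℓ _ _ U _ → let open WordQuotient K U ℓ in ⊛-closed , ∉-annihilates , x⊛≈xᵁ⊛) ,
  (λ F n ℓ _ _ U U-sub _ → let open FlagQuotient K F n U U-sub ℓ in ⊛-closed , ⊈-annihilates , x⊛≈xᵁ⊛)
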